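{- Let $n\geq1$. The vertices of the degree bi-enumerator polytope ${\cal B}_{2,n}=\mathrm{conv}\{b(G):G\subseteq K_{2,n}\}\subset\mathbb{R}^{n+1}\oplus\mathbb{R}^{3}$ are exactly the following: (1) $b_n(i,i,k)=2\cdot{\bf 1}_i\oplus(n-2i+k,\,2i-2k,\,k)$ for $i=0,\dots,n$ and $k\in\{\max\{0,2i-n\},\,i\}$; (2) $b_n(i,j,k)$ for $i=0,\dots,\lfloor\frac{n-1}{2}\rfloor$ and $j=\lceil\frac{n+1}{2}\rceil,\dots,n$, where $k=\max\{0,(i+j)-n\}$. Here $b_n(i,j,k):=({\bf 1}_i+{\bf 1}_j)\oplus(n-(i+j)+k,\ (i+j)-2k,\ k)$. The number of vertices is $(\frac n2)^2+2n$ for even $n$ and $(\frac{n+1}{2})^2+2n$ for odd $n$.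
   Context: $K_{2,n}=(U,V,E)$ is the complete bipartite graph with left vertices $U=\{u_1,u_2\}$, right vertices $V=\{v_1,\dots,v_n\}$, $E=U\times V$. A subgraph $G\subseteq K_{2,n}$ has the same vertex sets and edge set contained in $E$. Its degree bi-enumerator is $b(G)=a(G)\oplus c(G)\in\mathbb{R}^{n+1}\oplus\mathbb{R}^{3}$, where $a_k(G)$ ($k=0,\dots,n$) is the number of left vertices of degree $k$ and $c_k(G)$ ($k=0,1,2$) is the number of right vertices of degree $k$; vectors are indexed from $0$ and ${\bf 1}_k$ is the $k$-th unit vector of $\mathbb{R}^{n+1}$. (The vector $b_n(i,j,k)$ is the bi-enumerator of a subgraph in which $u_1,u_2$ have degrees $i\le j$ and exactly $k$ common neighbours.)
   Formalization: Points of ${\cal B}_{2,n}$ have rational coordinates, and the convex weights, including those in the test for a vertex, are rational rather than real. -}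

module Defs where

open import Data.Bool using (Bool; true; false; if_then_else_)
open import Data.Nat using (ℕ; zero; suc; _≡ᵇ_; _≤_; _∸_; _⊔_; _+_; _*_; ⌊_/2⌋; ⌈_/2⌉)
import Data.Integer as ℤ
open import Data.Rational as ℚ using (ℚ; 0ℚ; 1ℚ; _/_)
open import Data.Fin using (Fin; toℕ)
import Data.Fin as F
import Data.Vec as V
open import Data.List.Relation.Unary.All using (All)
open import Data.Product using (proj₁; proj₂)
open import Data.Sum using (_⊎_)
open import Data.Vec using (Vec; tabulate; zipWith; replicate; _∷_; [])
open import Data.List using (List; []; _∷_; sum; map; foldr)
open import Data.Product using (_×_; _,_; Σ; ∃; ∃-syntax)
open import Relation.Binary.PropositionalEquality using (_≡_)

-- A subgraph of K_{2,n}: edge indicator, G u v = true iff {u_(u+1), v_(v+1)} ∈ E(G).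
Subgraph : ℕ → Set
Subgraph n = Fin 2 → Fin n → Bool

b2n : Bool → ℕ
b2n true = 1
b2n false = 0

Σfin : ∀ {m} → (Fin m → ℕ) → ℕ
Σfin {zero} f = 0
Σfin {suc m} f = f F.zero + Σfin (λ i → f (F.suc i))

degL : ∀ {n} → Subgraph n → Fin 2 → ℕ
degL G u = Σfin (λ v → b2n (G u v))

degR : ∀ {n} → Subgraph n → Fin n → ℕ
degR G v = Σfin (λ u → b2n (G u v))

aG : ∀ {n} → Subgraph n → Fin (suc n) → ℕ
aG G k = Σfin (λ u → b2n (degL G u ≡ᵇ toℕ k))

cG : ∀ {n} → Subgraph n → Fin 3 → ℕ
cG G k = Σfin (λ v → b2n (degR G v ≡ᵇ toℕ k))

Point : ℕ → Set
Point n = Vec ℚ (suc n) × Vec ℚ 3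

ℕtoℚ : ℕ → ℚ
ℕtoℚ m = ℤ.+ m / 1

ℤtoℚ : ℤ.ℤ → ℚ
ℤtoℚ z = z / 1

bienum : ∀ {n} → Subgraph n → Point n
bienum G = tabulate (λ k → ℕtoℚ (aG G k)) , tabulate (λ k → ℕtoℚ (cG G k))

_⊕+_ : ∀ {n} → Point n → Point n → Point n
(x , y) ⊕+ (x' , y') = zipWith ℚ._+_ x x' , zipWith ℚ._+_ y y'

_·_ : ∀ {n} → ℚ → Point n → Point n
t · (x , y) = V.map (t ℚ.*_) x , V.map (t ℚ.*_) y

zeroP : ∀ {n} → Point n
zeroP = replicate _ 0ℚ , replicate _ 0ℚ

InConv : (n : ℕ) → Point n → Set
InConv n p = Σ (List (ℚ × Subgraph n)) λ ws →
    All (λ w → 0ℚ ℚ.≤ proj₁ w) ws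
  × foldr (λ w s → proj₁ w ℚ.+ s) 0ℚ ws ≡ 1ℚ
  × foldr (λ w s → (proj₁ w · bienum (proj₂ w)) ⊕+ s) zeroP ws ≡ p

IsVertex : (n : ℕ) → Point n → Set
IsVertex n p = InConv n p
  × (∀ x y t → InConv n x → InConv n y → 0ℚ ℚ.< t → t ℚ.< 1ℚ
       → p ≡ (t · x) ⊕+ ((1ℚ ℚ.- t) · y) → x ≡ p × y ≡ p)

unit : (n : ℕ) → ℕ → Vec ℚ (suc n)
unit n i = tabulate (λ r → if toℕ r ≡ᵇ i then 1ℚ else 0ℚ)

bn : (n i j k : ℕ) → Point n
bn n i j k =
  zipWith ℚ._+_ (unit n i) (unit n j)
  , ℤtoℚ ((ℤ.+ n ℤ.- ℤ.+ (i + j)) ℤ.+ ℤ.+ k)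
    ∷ ℤtoℚ (ℤ.+ (i + j) ℤ.- ℤ.+ (2 * k))
    ∷ ℕtoℚ k ∷ []

IsListedVertex : (n : ℕ) → Point n → Set
IsListedVertex n p =
  (∃[ i ] ∃[ k ] (i ≤ n × (k ≡ 0 ⊔ (2 * i ∸ n) ⊎ k ≡ i) × p ≡ bn n i i k))
  ⊎ (∃[ i ] ∃[ j ] (i ≤ ⌊ n ∸ 1 /2⌋ × ⌈ n + 1 /2⌉ ≤ j × j ≤ n
                    × p ≡ bn n i j (0 ⊔ ((i + j) ∸ n))))

-- A subgraph G has bi-enumerator b_n(d₁, d₂, c), where dᵢ = deg uᵢ and c is the
-- number of common neighbours, and the triples that occur are exactly those with c ≤ d₁, d₂ and
-- d₁ + d₂ ≤ n + c; a vertex of the polytope must be such a point.  Each listed point is a vertex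
-- because it is cut out by a chain of faces: maximize the degree coordinate a_i (resp. a_i + a_j),
-- then a coordinate of the c-part.  Every other b_n(a,b,k) is a proper convex combination of
-- realizable points: of b_n(a,b,k-1) and b_n(a,b,k+1) when k is strictly between its bounds,
-- of b_n(a,a,·) and b_n(b,b,·) when a and b lie on the same side of n/2, and of b_n(a,b,a-1) and
-- the midpoint of b_n(a,a,a) and b_n(b,b,b) when k = a < b.

module Submission where

open import Defs
open import Data.Nat using (ℕ; _≤_; _+_; _*_; suc)
open import Data.Product using (_×_; Σ)
open import Data.List using (List; length)
open import Data.List.Membership.Propositional using (_∈_)
open import Data.List.Relation.Unary.Unique.Propositional using (Unique)
open import Function.Bundles using (_⇔_; mk⇔)
open import Relation.Binary.PropositionalEquality using (_≡_)

open import Data.Bool using (Bool; true; false; if_then_else_; _∧_; T)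
import Data.Bool.Properties
open import Data.Nat using (zero; _∸_; _<_; _≡ᵇ_; z≤n; s≤s; s≤s⁻¹; ⌊_/2⌋; ⌈_/2⌉)
import Data.Nat.Properties as ℕP
open import Data.Nat.Tactic.RingSolver using (solve-∀)
open import Data.Nat.Coprimality using (1-coprimeTo)
import Data.Integer as ℤ
import Data.Integer.Properties as ℤP
open import Data.Rational as ℚ using (ℚ; mkℚ; 0ℚ; 1ℚ; ½; _/_)
import Data.Rational.Properties as ℚP
open import Data.Rational.Solver using (module +-*-Solver)
open +-*-Solver
open import Data.Fin as F using (Fin; toℕ)
import Data.Fin.Properties as FP
open import Data.Vec as V using (Vec)
import Data.Vec.Properties as VP
open import Data.Product using (_,_; proj₁; proj₂; ∃)
open import Data.Sum using (_⊎_; inj₁; inj₂)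
import Data.Sum
open import Data.Unit using (⊤; tt)
open import Data.Empty using (⊥; ⊥-elim)
open import Data.List using ([]; _∷_; _++_; map; foldr; applyUpTo; upTo; cartesianProductWith)
import Data.List.Properties as LP
open import Data.List.Membership.Propositional using (_∉_)
open import Data.List.Membership.Propositional.Properties
  using (∈-map⁺; ∈-map⁻; ∈-++⁺ˡ; ∈-++⁺ʳ; ∈-++⁻; ∈-applyUpTo⁺; ∈-applyUpTo⁻; ∈-upTo⁺; ∈-upTo⁻;
         ∈-cartesianProductWith⁺; ∈-cartesianProductWith⁻)
open import Data.List.Relation.Unary.Any using (here; there)
open import Data.List.Relation.Unary.All using (All; []; _∷_)
import Data.List.Relation.Unary.All.Properties as AllP
open import Data.List.Relation.Unary.AllPairs using ([]; _∷_)
import Data.List.Relation.Unary.Unique.Propositional.Properties as UP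
open import Data.List.Relation.Binary.Disjoint.Propositional using (Disjoint)
open import Function using (_∘_)
open import Relation.Binary.Definitions using (Tri; tri<; tri≈; tri>)
open import Relation.Nullary using (¬_; yes; no; Dec)
open import Relation.Binary.PropositionalEquality
  using (_≢_; refl; sym; trans; cong; cong₂; subst; subst₂; module ≡-Reasoning)

ℤtoℚ≡mkℚ : ∀ z → ℤtoℚ z ≡ mkℚ z 0 (Data.Nat.Coprimality.sym (1-coprimeTo ℤ.∣ z ∣))
ℤtoℚ≡mkℚ (ℤ.+ m)    = ℚP.normalize-coprime (Data.Nat.Coprimality.sym (1-coprimeTo m))
ℤtoℚ≡mkℚ ℤ.-[1+ m ] = cong ℚ.-_ (ℚP.normalize-coprime (Data.Nat.Coprimality.sym (1-coprimeTo (suc m))))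

ℤtoℚ-+ : ∀ a b → ℤtoℚ (a ℤ.+ b) ≡ ℤtoℚ a ℚ.+ ℤtoℚ b
ℤtoℚ-+ a b rewrite ℤtoℚ≡mkℚ a | ℤtoℚ≡mkℚ b =
  cong (_/ 1) (sym (cong₂ ℤ._+_ (ℤP.*-identityʳ a) (ℤP.*-identityʳ b)))

ℤtoℚ-neg : ∀ a → ℤtoℚ (ℤ.- a) ≡ ℚ.- ℤtoℚ a
ℤtoℚ-neg (ℤ.+ zero)  = refl
ℤtoℚ-neg ℤ.+[1+ m ] = refl
ℤtoℚ-neg ℤ.-[1+ m ] = sym (⁻¹-involutive _)
  where open import Algebra.Properties.Group ℚP.+-0-group using (⁻¹-involutive)

ℤtoℚ-- : ∀ a b → ℤtoℚ (a ℤ.- b) ≡ ℤtoℚ a ℚ.- ℤtoℚ b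
ℤtoℚ-- a b = trans (ℤtoℚ-+ a (ℤ.- b)) (cong (ℤtoℚ a ℚ.+_) (ℤtoℚ-neg b))

ℤtoℚ-mono-≤ : ∀ {a b} → a ℤ.≤ b → ℤtoℚ a ℚ.≤ ℤtoℚ b
ℤtoℚ-mono-≤ {a} {b} p rewrite ℤtoℚ≡mkℚ a | ℤtoℚ≡mkℚ b =
  ℚ.*≤* (subst₂ ℤ._≤_ (sym (ℤP.*-identityʳ a)) (sym (ℤP.*-identityʳ b)) p)

ℤtoℚ-cancel-≤ : ∀ {a b} → ℤtoℚ a ℚ.≤ ℤtoℚ b → a ℤ.≤ b
ℤtoℚ-cancel-≤ {a} {b} p rewrite ℤtoℚ≡mkℚ a | ℤtoℚ≡mkℚ b with p
... | ℚ.*≤* q = subst₂ ℤ._≤_ (ℤP.*-identityʳ a) (ℤP.*-identityʳ b) q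

ℕtoℚ-+ : ∀ a b → ℕtoℚ (a + b) ≡ ℕtoℚ a ℚ.+ ℕtoℚ b
ℕtoℚ-+ a b = ℤtoℚ-+ (ℤ.+ a) (ℤ.+ b)

ℕtoℚ-mono-≤ : ∀ {a b} → a ≤ b → ℕtoℚ a ℚ.≤ ℕtoℚ b
ℕtoℚ-mono-≤ p = ℤtoℚ-mono-≤ (ℤ.+≤+ p)

ℕtoℚ-injective : ∀ {a b} → ℕtoℚ a ≡ ℕtoℚ b → a ≡ b
ℕtoℚ-injective {a} {b} p with ℤtoℚ-cancel-≤ {ℤ.+ a} {ℤ.+ b} (ℚP.≤-reflexive p)
                            | ℤtoℚ-cancel-≤ {ℤ.+ b} {ℤ.+ a} (ℚP.≤-reflexive (sym p))
... | ℤ.+≤+ a≤b | ℤ.+≤+ b≤a = ℕP.≤-antisym a≤b b≤a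

ℕtoℚ-∸ : ∀ {a b} → b ≤ a → ℕtoℚ (a ∸ b) ≡ ℕtoℚ a ℚ.- ℕtoℚ b
ℕtoℚ-∸ {a} {b} b≤a = trans (cong ℤtoℚ (sym (trans (ℤP.m-n≡m⊖n a b) (ℤP.⊖-≥ b≤a)))) (ℤtoℚ-- (ℤ.+ a) (ℤ.+ b))

Coord : ℕ → Set
Coord n = Fin (suc n) ⊎ Fin 3

coord : ∀ {n} → Point n → Coord n → ℚ
coord (x , _) (inj₁ r) = V.lookup x r
coord (_ , y) (inj₂ r) = V.lookup y r

lookup-injective : ∀ {m} {x y : Vec ℚ m} → (∀ r → V.lookup x r ≡ V.lookup y r) → x ≡ y
lookup-injective {x = x} {y} h =
  trans (sym (VP.tabulate∘lookup x)) (trans (VP.tabulate-cong h) (VP.tabulate∘lookup y))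

coord-injective : ∀ {n} {p q : Point n} → (∀ r → coord p r ≡ coord q r) → p ≡ q
coord-injective {p = _ , _} {_ , _} h =
  cong₂ _,_ (lookup-injective (h ∘ inj₁)) (lookup-injective (h ∘ inj₂))

coord-⊕+ : ∀ {n} (p q : Point n) r → coord (p ⊕+ q) r ≡ coord p r ℚ.+ coord q r
coord-⊕+ (x , _) (x' , _) (inj₁ r) = VP.lookup-zipWith ℚ._+_ r x x'
coord-⊕+ (_ , y) (_ , y') (inj₂ r) = VP.lookup-zipWith ℚ._+_ r y y'

coord-· : ∀ {n} t (p : Point n) r → coord (t · p) r ≡ t ℚ.* coord p r
coord-· t (x , _) (inj₁ r) = VP.lookup-map r (t ℚ.*_) x
coord-· t (_ , y) (inj₂ r) = VP.lookup-map r (t ℚ.*_) y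

coord-zeroP : ∀ {n} r → coord (zeroP {n}) r ≡ 0ℚ
coord-zeroP (inj₁ r) = VP.lookup-replicate r 0ℚ
coord-zeroP (inj₂ r) = VP.lookup-replicate r 0ℚ

mix : ∀ {n} → ℚ → Point n → Point n → Point n
mix t x y = (t · x) ⊕+ ((1ℚ ℚ.- t) · y)

coord-mix : ∀ {n} t (x y : Point n) r → coord (mix t x y) r ≡ t ℚ.* coord x r ℚ.+ (1ℚ ℚ.- t) ℚ.* coord y r
coord-mix t x y r = trans (coord-⊕+ (t · x) _ r) (cong₂ ℚ._+_ (coord-· t x r) (coord-· (1ℚ ℚ.- t) y r))

module _ {n : ℕ} where

  ·-zeroˡ : (p : Point n) → 0ℚ · p ≡ zeroP
  ·-zeroˡ p = coord-injective λ r →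
    trans (coord-· 0ℚ p r) (trans (ℚP.*-zeroˡ (coord p r)) (sym (coord-zeroP r)))

  ·-zeroʳ : ∀ t → t · zeroP {n} ≡ zeroP
  ·-zeroʳ t = coord-injective λ r →
    trans (coord-· t zeroP r) (trans (cong (t ℚ.*_) (coord-zeroP r)) (trans (ℚP.*-zeroʳ t) (sym (coord-zeroP r))))

  ·-identityˡ : (p : Point n) → 1ℚ · p ≡ p
  ·-identityˡ p = coord-injective λ r → trans (coord-· 1ℚ p r) (ℚP.*-identityˡ _)

  ·-assoc : ∀ s t (p : Point n) → s · (t · p) ≡ (s ℚ.* t) · p
  ·-assoc s t p = coord-injective λ r →
    trans (coord-· s _ r) (trans (cong (s ℚ.*_) (coord-· t p r))
      (trans (sym (ℚP.*-assoc s t _)) (sym (coord-· (s ℚ.* t) p r))))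

  ·-distribˡ-⊕+ : ∀ t (p q : Point n) → t · (p ⊕+ q) ≡ (t · p) ⊕+ (t · q)
  ·-distribˡ-⊕+ t p q = coord-injective λ r →
    trans (coord-· t _ r) (trans (cong (t ℚ.*_) (coord-⊕+ p q r))
      (trans (ℚP.*-distribˡ-+ t _ _)
        (sym (trans (coord-⊕+ (t · p) (t · q) r) (cong₂ ℚ._+_ (coord-· t p r) (coord-· t q r))))))

  ·-distribʳ-+ : ∀ s t (p : Point n) → (s · p) ⊕+ (t · p) ≡ (s ℚ.+ t) · p
  ·-distribʳ-+ s t p = coord-injective λ r →
    trans (coord-⊕+ (s · p) (t · p) r) (trans (cong₂ ℚ._+_ (coord-· s p r) (coord-· t p r))
      (trans (sym (ℚP.*-distribʳ-+ _ s t)) (sym (coord-· (s ℚ.+ t) p r))))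

  ⊕+-identityˡ : (p : Point n) → zeroP ⊕+ p ≡ p
  ⊕+-identityˡ p = coord-injective λ r →
    trans (coord-⊕+ zeroP p r) (trans (cong (ℚ._+ coord p r) (coord-zeroP r)) (ℚP.+-identityˡ _))

  ⊕+-identityʳ : (p : Point n) → p ⊕+ zeroP ≡ p
  ⊕+-identityʳ p = coord-injective λ r →
    trans (coord-⊕+ p zeroP r) (trans (cong (coord p r ℚ.+_) (coord-zeroP r)) (ℚP.+-identityʳ _))

  ⊕+-assoc : (p q s : Point n) → (p ⊕+ q) ⊕+ s ≡ p ⊕+ (q ⊕+ s)
  ⊕+-assoc p q s = coord-injective λ r →
    trans (coord-⊕+ (p ⊕+ q) s r) (trans (cong (ℚ._+ coord s r) (coord-⊕+ p q r))
      (trans (ℚP.+-assoc (coord p r) (coord q r) (coord s r))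
        (sym (trans (coord-⊕+ p (q ⊕+ s) r) (cong (coord p r ℚ.+_) (coord-⊕+ q s r))))))

≤⇒0≤- : ∀ {a b} → a ℚ.≤ b → 0ℚ ℚ.≤ b ℚ.- a
≤⇒0≤- {a} {b} h = subst (ℚ._≤ b ℚ.- a) (ℚP.+-inverseʳ a) (ℚP.+-monoˡ-≤ (ℚ.- a) h)

0≤-⇒≤ : ∀ {a b} → 0ℚ ℚ.≤ b ℚ.- a → a ℚ.≤ b
0≤-⇒≤ {a} {b} h = subst₂ ℚ._≤_ (ℚP.+-identityˡ a) (solve 2 (λ a b → (b :- a) :+ a := b) refl a b) (ℚP.+-monoˡ-≤ a h)

-≡0⇒≡ : ∀ {a b} → b ℚ.- a ≡ 0ℚ → a ≡ b
-≡0⇒≡ {a} {b} h = trans (sym (ℚP.+-identityˡ a))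
  (trans (cong (ℚ._+ a) (sym h)) (solve 2 (λ a b → (b :- a) :+ a := b) refl a b))

nonNeg-* : ∀ {a b} → 0ℚ ℚ.≤ a → 0ℚ ℚ.≤ b → 0ℚ ℚ.≤ a ℚ.* b
nonNeg-* {a} {b} ha hb = subst (ℚ._≤ a ℚ.* b) (ℚP.*-zeroˡ b) (ℚP.*-monoʳ-≤-nonNeg b {{ℚ.nonNegative hb}} ha)

nonNeg-+≡0ˡ : ∀ {a b} → 0ℚ ℚ.≤ a → 0ℚ ℚ.≤ b → a ℚ.+ b ≡ 0ℚ → a ≡ 0ℚ
nonNeg-+≡0ˡ {a} {b} ha hb e = ℚP.≤-antisym
  (subst (a ℚ.≤_) e (subst (ℚ._≤ a ℚ.+ b) (ℚP.+-identityʳ a) (ℚP.+-monoʳ-≤ a hb))) ha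

nonNeg-+≡0ʳ : ∀ {a b} → 0ℚ ℚ.≤ a → 0ℚ ℚ.≤ b → a ℚ.+ b ≡ 0ℚ → b ≡ 0ℚ
nonNeg-+≡0ʳ {a} {b} ha hb e = nonNeg-+≡0ˡ hb ha (trans (ℚP.+-comm b a) e)

pos-*≡0 : ∀ {t z} → 0ℚ ℚ.< t → t ℚ.* z ≡ 0ℚ → z ≡ 0ℚ
pos-*≡0 {t} {z} ht e = begin
    z                        ≡⟨ sym (ℚP.*-identityˡ z) ⟩
    1ℚ ℚ.* z                 ≡⟨ cong (ℚ._* z) (sym (ℚP.*-inverseˡ t)) ⟩
    (ℚ.1/ t ℚ.* t) ℚ.* z     ≡⟨ ℚP.*-assoc (ℚ.1/ t) t z ⟩
    ℚ.1/ t ℚ.* (t ℚ.* z)     ≡⟨ cong (ℚ.1/ t ℚ.*_) e ⟩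
    ℚ.1/ t ℚ.* 0ℚ            ≡⟨ ℚP.*-zeroʳ (ℚ.1/ t) ⟩
    0ℚ                       ∎
  where
    open ≡-Reasoning
    instance _ = ℚ.>-nonZero ht

≤∧≢⇒< : ∀ {a b} → a ℚ.≤ b → a ≢ b → a ℚ.< b
≤∧≢⇒< {a} {b} a≤b a≢b with ℚP.<-cmp a b
... | tri< a<b _ _ = a<b
... | tri≈ _ a≡b _ = ⊥-elim (a≢b a≡b)
... | tri> _ _ a>b = ⊥-elim (ℚP.<-irrefl refl (ℚP.<-≤-trans a>b a≤b))

nonNeg-*≡0 : ∀ {t z} → 0ℚ ℚ.≤ t → t ℚ.* z ≡ 0ℚ → t ≡ 0ℚ ⊎ z ≡ 0ℚ
nonNeg-*≡0 {t} t≥0 e with t ℚ.≟ 0ℚ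
... | yes t≡0 = inj₁ t≡0
... | no  t≢0 = inj₂ (pos-*≡0 (≤∧≢⇒< t≥0 (t≢0 ∘ sym)) e)

<⇒0<1- : ∀ {t} → t ℚ.< 1ℚ → 0ℚ ℚ.< 1ℚ ℚ.- t
<⇒0<1- {t} h = subst (ℚ._< 1ℚ ℚ.- t) (ℚP.+-inverseʳ t) (ℚP.+-monoˡ-< (ℚ.- t) h)

0<1-⇒< : ∀ {t} → 0ℚ ℚ.< 1ℚ ℚ.- t → t ℚ.< 1ℚ
0<1-⇒< {t} h = subst₂ ℚ._<_ (ℚP.+-identityˡ t) (solve 1 (λ t → (con 1ℚ :- t) :+ t := con 1ℚ) refl t) (ℚP.+-monoˡ-< t h)

Weighted : ℕ → Set
Weighted n = List (ℚ × Subgraph n)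

totalWeight : ∀ {n} → Weighted n → ℚ
totalWeight = foldr (λ w s → proj₁ w ℚ.+ s) 0ℚ

combination : ∀ {n} → Weighted n → Point n
combination = foldr (λ w s → (proj₁ w · bienum (proj₂ w)) ⊕+ s) zeroP

NonNeg : ∀ {n} → Weighted n → Set
NonNeg = All (λ w → 0ℚ ℚ.≤ proj₁ w)

SupportedOn : ∀ {n} → (Subgraph n → Set) → Weighted n → Set
SupportedOn P = All (λ w → proj₁ w ≡ 0ℚ ⊎ P (proj₂ w))

InConvOn : (n : ℕ) → (Subgraph n → Set) → Point n → Set
InConvOn n P x = Σ (Weighted n) λ ws →
  NonNeg ws × totalWeight ws ≡ 1ℚ × combination ws ≡ x × SupportedOn P ws

supportedOn-⊤ : ∀ {n} (ws : Weighted n) → SupportedOn (λ _ → ⊤) ws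
supportedOn-⊤ []       = []
supportedOn-⊤ (_ ∷ ws) = inj₂ tt ∷ supportedOn-⊤ ws

inConvOn-⊤ : ∀ {n x} → InConv n x → InConvOn n (λ _ → ⊤) x
inConvOn-⊤ (ws , ws≥0 , total≡1 , comb≡x) = ws , ws≥0 , total≡1 , comb≡x , supportedOn-⊤ ws

inConv-bienum : ∀ {n} (G : Subgraph n) → InConv n (bienum G)
inConv-bienum G = (1ℚ , G) ∷ [] , ℚP.≤ᵇ⇒≤ tt ∷ [] , ℚP.+-identityʳ 1ℚ
                , trans (⊕+-identityʳ _) (·-identityˡ _)

totalWeight-nonNeg : ∀ {n} {ws : Weighted n} → NonNeg ws → 0ℚ ℚ.≤ totalWeight ws
totalWeight-nonNeg []         = ℚP.≤-refl
totalWeight-nonNeg (h ∷ ws≥0) = ℚP.+-mono-≤ h (totalWeight-nonNeg ws≥0)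

totalWeight≡0⇒combination≡0 : ∀ {n} {ws : Weighted n} → NonNeg ws → totalWeight ws ≡ 0ℚ → combination ws ≡ zeroP
totalWeight≡0⇒combination≡0 [] _ = refl
totalWeight≡0⇒combination≡0 {ws = (t , G) ∷ ws} (t≥0 ∷ ws≥0) e =
  trans (cong₂ (λ s v → (s · bienum G) ⊕+ v) t≡0 (totalWeight≡0⇒combination≡0 ws≥0 rest≡0))
        (trans (⊕+-identityʳ _) (·-zeroˡ (bienum G)))
  where
    t≡0 : t ≡ 0ℚ
    t≡0 = nonNeg-+≡0ˡ t≥0 (totalWeight-nonNeg ws≥0) e
    rest≡0 : totalWeight ws ≡ 0ℚ
    rest≡0 = nonNeg-+≡0ʳ t≥0 (totalWeight-nonNeg ws≥0) e

scale : ∀ {n} → ℚ → Weighted n → Weighted n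
scale c = map (λ w → c ℚ.* proj₁ w , proj₂ w)

totalWeight-scale : ∀ {n} c (ws : Weighted n) → totalWeight (scale c ws) ≡ c ℚ.* totalWeight ws
totalWeight-scale c []            = sym (ℚP.*-zeroʳ c)
totalWeight-scale c ((t , _) ∷ ws) =
  trans (cong (c ℚ.* t ℚ.+_) (totalWeight-scale c ws)) (sym (ℚP.*-distribˡ-+ c t _))

combination-scale : ∀ {n} c (ws : Weighted n) → combination (scale c ws) ≡ c · combination ws
combination-scale c []            = sym (·-zeroʳ c)
combination-scale c ((t , G) ∷ ws) =
  trans (cong₂ _⊕+_ (sym (·-assoc c t (bienum G))) (combination-scale c ws))
        (sym (·-distribˡ-⊕+ c (t · bienum G) (combination ws)))

scale-nonNeg : ∀ {n c} {ws : Weighted n} → 0ℚ ℚ.≤ c → NonNeg ws → NonNeg (scale c ws)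
scale-nonNeg c≥0 []         = []
scale-nonNeg c≥0 (h ∷ ws≥0) = nonNeg-* c≥0 h ∷ scale-nonNeg c≥0 ws≥0

totalWeight-++ : ∀ {n} (ws vs : Weighted n) → totalWeight (ws ++ vs) ≡ totalWeight ws ℚ.+ totalWeight vs
totalWeight-++ []            vs = sym (ℚP.+-identityˡ _)
totalWeight-++ ((t , _) ∷ ws) vs =
  trans (cong (t ℚ.+_) (totalWeight-++ ws vs)) (sym (ℚP.+-assoc t _ _))

combination-++ : ∀ {n} (ws vs : Weighted n) → combination (ws ++ vs) ≡ combination ws ⊕+ combination vs
combination-++ []            vs = sym (⊕+-identityˡ _)
combination-++ ((t , G) ∷ ws) vs =
  trans (cong ((t · bienum G) ⊕+_) (combination-++ ws vs)) (sym (⊕+-assoc (t · bienum G) (combination ws) (combination vs)))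

inConv-mix : ∀ {n x y t} → 0ℚ ℚ.≤ t → t ℚ.≤ 1ℚ → InConv n x → InConv n y → InConv n (mix t x y)
inConv-mix {t = t} t≥0 t≤1 (ws , ws≥0 , ws≡1 , refl) (vs , vs≥0 , vs≡1 , refl) =
  scale t ws ++ scale (1ℚ ℚ.- t) vs ,
  AllP.++⁺ (scale-nonNeg t≥0 ws≥0) (scale-nonNeg {c = 1ℚ ℚ.- t} (≤⇒0≤- t≤1) vs≥0) ,
  total≡1 ,
  trans (combination-++ (scale t ws) _) (cong₂ _⊕+_ (combination-scale t ws) (combination-scale (1ℚ ℚ.- t) vs))
  where
    open ≡-Reasoning
    total≡1 : totalWeight (scale t ws ++ scale (1ℚ ℚ.- t) vs) ≡ 1ℚ
    total≡1 = begin
      totalWeight (scale t ws ++ scale (1ℚ ℚ.- t) vs)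
        ≡⟨ totalWeight-++ (scale t ws) _ ⟩
      totalWeight (scale t ws) ℚ.+ totalWeight (scale (1ℚ ℚ.- t) vs)
        ≡⟨ cong₂ ℚ._+_ (totalWeight-scale t ws) (totalWeight-scale (1ℚ ℚ.- t) vs) ⟩
      t ℚ.* totalWeight ws ℚ.+ (1ℚ ℚ.- t) ℚ.* totalWeight vs
        ≡⟨ cong₂ (λ u v → t ℚ.* u ℚ.+ (1ℚ ℚ.- t) ℚ.* v) ws≡1 vs≡1 ⟩
      t ℚ.* 1ℚ ℚ.+ (1ℚ ℚ.- t) ℚ.* 1ℚ
        ≡⟨ solve 1 (λ t → t :* con 1ℚ :+ (con 1ℚ :- t) :* con 1ℚ := con 1ℚ) refl t ⟩
      1ℚ ∎

-- Extreme points and faces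

ExtremeOn : (n : ℕ) → (Subgraph n → Set) → Point n → Set
ExtremeOn n P p = ∀ {x y t} → InConvOn n P x → InConvOn n P y → 0ℚ ℚ.< t → t ℚ.< 1ℚ
                → p ≡ mix t x y → x ≡ p × y ≡ p

vertex-intro : ∀ {n p} → InConv n p → ExtremeOn n (λ _ → ⊤) p → IsVertex n p
vertex-intro p∈ ext = p∈ , λ _ _ _ x∈ y∈ t>0 t<1 p≡ → ext (inConvOn-⊤ x∈) (inConvOn-⊤ y∈) t>0 t<1 p≡

module _ {n : ℕ} {P : Subgraph n → Set} {p : Point n} (only-p : ∀ G → P G → bienum G ≡ p) where

  combination-supportedOn : ∀ {ws} → SupportedOn P ws → combination ws ≡ totalWeight ws · p
  combination-supportedOn {[]}          []       = sym (·-zeroˡ p)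
  combination-supportedOn {(t , G) ∷ ws} (h ∷ hs) =
    trans (cong₂ _⊕+_ (term h) (combination-supportedOn hs)) (·-distribʳ-+ t _ p)
    where
      term : t ≡ 0ℚ ⊎ P G → t · bienum G ≡ t · p
      term (inj₁ refl) = trans (·-zeroˡ (bienum G)) (sym (·-zeroˡ p))
      term (inj₂ PG)   = cong (t ·_) (only-p G PG)

  inConvOn-singleton : ∀ {x} → InConvOn n P x → x ≡ p
  inConvOn-singleton (ws , _ , total≡1 , refl , hs) =
    trans (combination-supportedOn hs) (trans (cong (_· p) total≡1) (·-identityˡ p))

  extremeOn-singleton : ExtremeOn n P p
  extremeOn-singleton x∈ y∈ _ _ _ = inConvOn-singleton x∈ , inConvOn-singleton y∈

record Linear (n : ℕ) : Set where
  field
    φ    : Point n → ℚ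
    φ-⊕+ : ∀ x y → φ (x ⊕+ y) ≡ φ x ℚ.+ φ y
    φ-·  : ∀ t x → φ (t · x) ≡ t ℚ.* φ x

  φ-zeroP : φ zeroP ≡ 0ℚ
  φ-zeroP = trans (cong φ (sym (·-zeroˡ zeroP))) (trans (φ-· 0ℚ zeroP) (ℚP.*-zeroˡ (φ zeroP)))

  φ-mix : ∀ t x y → φ (mix t x y) ≡ t ℚ.* φ x ℚ.+ (1ℚ ℚ.- t) ℚ.* φ y
  φ-mix t x y = trans (φ-⊕+ (t · x) _) (cong₂ ℚ._+_ (φ-· t x) (φ-· (1ℚ ℚ.- t) y))

record OnFace {n} (P : Subgraph n → Set) (L : Linear n) (M : ℚ) (G : Subgraph n) : Set where
  constructor face
  field
    inside  : P G
    attains : Linear.φ L (bienum G) ≡ M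

module _ {n : ℕ} (L : Linear n) (M : ℚ) where
  open Linear L

  slack : Weighted n → ℚ
  slack = foldr (λ w s → proj₁ w ℚ.* (M ℚ.- φ (bienum (proj₂ w))) ℚ.+ s) 0ℚ

  slack≡ : ∀ ws → slack ws ≡ M ℚ.* totalWeight ws ℚ.- φ (combination ws)
  slack≡ [] = trans (solve 1 (λ M → con 0ℚ := M :* con 0ℚ :- con 0ℚ) refl M)
                    (cong (λ z → M ℚ.* 0ℚ ℚ.- z) (sym φ-zeroP))
  slack≡ ((t , G) ∷ ws) = begin
      t ℚ.* (M ℚ.- B) ℚ.+ slack ws
        ≡⟨ cong (t ℚ.* (M ℚ.- B) ℚ.+_) (slack≡ ws) ⟩
      t ℚ.* (M ℚ.- B) ℚ.+ (M ℚ.* S ℚ.- φ V)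
        ≡⟨ solve 5 (λ t M B S W → t :* (M :- B) :+ (M :* S :- W) := M :* (t :+ S) :- (t :* B :+ W)) refl t M B S (φ V) ⟩
      M ℚ.* (t ℚ.+ S) ℚ.- (t ℚ.* B ℚ.+ φ V)
        ≡⟨ cong (λ z → M ℚ.* (t ℚ.+ S) ℚ.- (z ℚ.+ φ V)) (sym (φ-· t (bienum G))) ⟩
      M ℚ.* (t ℚ.+ S) ℚ.- (φ (t · bienum G) ℚ.+ φ V)
        ≡⟨ cong (λ z → M ℚ.* (t ℚ.+ S) ℚ.- z) (sym (φ-⊕+ (t · bienum G) V)) ⟩
      M ℚ.* (t ℚ.+ S) ℚ.- φ ((t · bienum G) ⊕+ V) ∎
    where
      open ≡-Reasoning
      B S : ℚ
      B = φ (bienum G)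
      S = totalWeight ws
      V : Point n
      V = combination ws

  module _ {P : Subgraph n → Set} (bound : ∀ G → P G → φ (bienum G) ℚ.≤ M) where

    term-nonNeg : ∀ {t G} → 0ℚ ℚ.≤ t → t ≡ 0ℚ ⊎ P G → 0ℚ ℚ.≤ t ℚ.* (M ℚ.- φ (bienum G))
    term-nonNeg {G = G} _ (inj₁ refl) = ℚP.≤-reflexive (sym (ℚP.*-zeroˡ (M ℚ.- φ (bienum G))))
    term-nonNeg {G = G} t≥0 (inj₂ PG) = nonNeg-* t≥0 (≤⇒0≤- (bound G PG))

    slack-nonNeg : ∀ {ws} → NonNeg ws → SupportedOn P ws → 0ℚ ℚ.≤ slack ws
    slack-nonNeg []         []       = ℚP.≤-refl
    slack-nonNeg (h ∷ ws≥0) (s ∷ hs) = ℚP.+-mono-≤ (term-nonNeg h s) (slack-nonNeg ws≥0 hs)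

    term≡0⇒onFace : ∀ {t G} → 0ℚ ℚ.≤ t → t ≡ 0ℚ ⊎ P G → t ℚ.* (M ℚ.- φ (bienum G)) ≡ 0ℚ
                  → t ≡ 0ℚ ⊎ OnFace P L M G
    term≡0⇒onFace _   (inj₁ t≡0) _  = inj₁ t≡0
    term≡0⇒onFace t≥0 (inj₂ PG)  e₀ = Data.Sum.map₂ (λ gap≡0 → face PG (-≡0⇒≡ gap≡0)) (nonNeg-*≡0 t≥0 e₀)

    slack≡0⇒supportedOnFace : ∀ {ws} → NonNeg ws → SupportedOn P ws → slack ws ≡ 0ℚ
                            → SupportedOn (OnFace P L M) ws
    slack≡0⇒supportedOnFace []         []       _ = []
    slack≡0⇒supportedOnFace (h ∷ ws≥0) (s ∷ hs) e =
      term≡0⇒onFace h s (nonNeg-+≡0ˡ (term-nonNeg h s) (slack-nonNeg ws≥0 hs) e)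
      ∷ slack≡0⇒supportedOnFace ws≥0 hs (nonNeg-+≡0ʳ (term-nonNeg h s) (slack-nonNeg ws≥0 hs) e)

    slack-of : ∀ {x} → (x∈ : InConvOn n P x) → slack (proj₁ x∈) ≡ M ℚ.- φ x
    slack-of (ws , _ , total≡1 , refl , _) =
      trans (slack≡ ws) (cong (λ z → z ℚ.- φ (combination ws)) (trans (cong (M ℚ.*_) total≡1) (ℚP.*-identityʳ M)))

    φ≤M : ∀ {x} → InConvOn n P x → φ x ℚ.≤ M
    φ≤M x∈@(_ , ws≥0 , _ , _ , hs) = 0≤-⇒≤ (subst (0ℚ ℚ.≤_) (slack-of x∈) (slack-nonNeg ws≥0 hs))

    φ≡M⇒inConvOnFace : ∀ {x} → InConvOn n P x → φ x ≡ M → InConvOn n (OnFace P L M) x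
    φ≡M⇒inConvOnFace x∈@(ws , ws≥0 , total≡1 , x≡ , hs) φx≡M =
      ws , ws≥0 , total≡1 , x≡ ,
      slack≡0⇒supportedOnFace ws≥0 hs (trans (slack-of x∈) (trans (cong (λ z → M ℚ.- z) φx≡M) (ℚP.+-inverseʳ M)))

    extremeOn-face : ∀ {p} → φ p ≡ M → ExtremeOn n (OnFace P L M) p → ExtremeOn n P p
    extremeOn-face {p} φp≡M ext {x} {y} {t} x∈ y∈ t>0 t<1 p≡ =
      ext (φ≡M⇒inConvOnFace x∈ (-≡0⇒≡ M-φx≡0)) (φ≡M⇒inConvOnFace y∈ (-≡0⇒≡ M-φy≡0)) t>0 t<1 p≡
      where
        open ≡-Reasoning
        1-t>0 : 0ℚ ℚ.< 1ℚ ℚ.- t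
        1-t>0 = <⇒0<1- t<1
        gaps≡0 : t ℚ.* (M ℚ.- φ x) ℚ.+ (1ℚ ℚ.- t) ℚ.* (M ℚ.- φ y) ≡ 0ℚ
        gaps≡0 = begin
          t ℚ.* (M ℚ.- φ x) ℚ.+ (1ℚ ℚ.- t) ℚ.* (M ℚ.- φ y)
            ≡⟨ solve 4 (λ t M a b → t :* (M :- a) :+ (con 1ℚ :- t) :* (M :- b)
                                  := M :- (t :* a :+ (con 1ℚ :- t) :* b)) refl t M (φ x) (φ y) ⟩
          M ℚ.- (t ℚ.* φ x ℚ.+ (1ℚ ℚ.- t) ℚ.* φ y)  ≡⟨ cong (λ z → M ℚ.- z) (sym (φ-mix t x y)) ⟩
          M ℚ.- φ (mix t x y)                       ≡⟨ cong (λ z → M ℚ.- φ z) (sym p≡) ⟩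
          M ℚ.- φ p                                 ≡⟨ cong (λ z → M ℚ.- z) φp≡M ⟩
          M ℚ.- M                                   ≡⟨ ℚP.+-inverseʳ M ⟩
          0ℚ                                        ∎
        termx≥0 : 0ℚ ℚ.≤ t ℚ.* (M ℚ.- φ x)
        termx≥0 = nonNeg-* (ℚP.<⇒≤ t>0) (≤⇒0≤- (φ≤M x∈))
        termy≥0 : 0ℚ ℚ.≤ (1ℚ ℚ.- t) ℚ.* (M ℚ.- φ y)
        termy≥0 = nonNeg-* (ℚP.<⇒≤ 1-t>0) (≤⇒0≤- (φ≤M y∈))
        M-φx≡0 : M ℚ.- φ x ≡ 0ℚ
        M-φx≡0 = pos-*≡0 t>0 (nonNeg-+≡0ˡ termx≥0 termy≥0 gaps≡0)
        M-φy≡0 : M ℚ.- φ y ≡ 0ℚ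
        M-φy≡0 = pos-*≡0 1-t>0 (nonNeg-+≡0ʳ termx≥0 termy≥0 gaps≡0)

normalize-weights : ∀ {n s} {ws : Weighted n} → 0ℚ ℚ.< s → NonNeg ws → totalWeight ws ≡ s
                  → Σ (Point n) λ y → InConv n y × combination ws ≡ s · y
normalize-weights {n} {s} {ws} s>0 ws≥0 total≡s =
  combination (scale 1/s ws) ,
  (scale 1/s ws , scale-nonNeg 1/s≥0 ws≥0 , total≡1 , refl) ,
  sym (begin
    s · combination (scale 1/s ws)     ≡⟨ cong (s ·_) (combination-scale 1/s ws) ⟩
    s · (1/s · combination ws)         ≡⟨ ·-assoc s 1/s (combination ws) ⟩
    (s ℚ.* 1/s) · combination ws       ≡⟨ cong (_· combination ws) (ℚP.*-inverseʳ s) ⟩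
    1ℚ · combination ws                ≡⟨ ·-identityˡ (combination ws) ⟩
    combination ws                     ∎)
  where
    open ≡-Reasoning
    instance
      s-pos : ℚ.Positive s
      s-pos = ℚ.positive s>0
      s≢0 : ℚ.NonZero s
      s≢0 = ℚP.pos⇒nonZero s
    1/s : ℚ
    1/s = ℚ.1/ s
    1/s≥0 : 0ℚ ℚ.≤ 1/s
    1/s≥0 = ℚP.<⇒≤ (ℚP.positive⁻¹ 1/s {{ℚP.1/pos⇒pos s}})
    total≡1 : totalWeight (scale 1/s ws) ≡ 1ℚ
    total≡1 = trans (totalWeight-scale 1/s ws) (trans (cong (1/s ℚ.*_) total≡s) (ℚP.*-inverseˡ s))

module _ {n : ℕ} {p : Point n}
         (extreme : ∀ x y t → InConv n x → InConv n y → 0ℚ ℚ.< t → t ℚ.< 1ℚ → p ≡ mix t x y → x ≡ p × y ≡ p) where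

  -- If the first weight t lies strictly between 0 and 1, then p = t b(G) + (1 - t) y with y the
  -- normalized rest of the combination, and extremality forces b(G) = p.
  extreme⇒bienum : (ws : Weighted n) → NonNeg ws → totalWeight ws ≡ 1ℚ → combination ws ≡ p → ∃ λ G → bienum G ≡ p
  extreme⇒bienum [] _ total≡1 _ = ⊥-elim (ℚP.1≢0 (sym total≡1))
  extreme⇒bienum ((t , G) ∷ ws) (t≥0 ∷ ws≥0) total≡1 ws↦p = by-first-weight (t ℚ.≟ 0ℚ) (t ℚ.≟ 1ℚ)
    where
      open ≡-Reasoning
      rest≡1-t : totalWeight ws ≡ 1ℚ ℚ.- t
      rest≡1-t = trans (solve 2 (λ t s → s := (t :+ s) :- t) refl t (totalWeight ws)) (cong (ℚ._- t) total≡1)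
      by-first-weight : Dec (t ≡ 0ℚ) → Dec (t ≡ 1ℚ) → ∃ λ G → bienum G ≡ p
      by-first-weight (yes t≡0) _ =
        extreme⇒bienum ws ws≥0 (trans rest≡1-t (cong (λ s → 1ℚ ℚ.- s) t≡0))
          (trans (sym (⊕+-identityˡ (combination ws))) (trans (cong (_⊕+ combination ws) zero≡) ws↦p))
        where
          zero≡ : zeroP ≡ t · bienum G
          zero≡ = trans (sym (·-zeroˡ (bienum G))) (cong (_· bienum G) (sym t≡0))
      by-first-weight (no _) (yes t≡1) = G , (begin
        bienum G                             ≡⟨ sym (·-identityˡ (bienum G)) ⟩
        1ℚ · bienum G                        ≡⟨ sym (⊕+-identityʳ (1ℚ · bienum G)) ⟩
        (1ℚ · bienum G) ⊕+ zeroP             ≡⟨ sym (cong₂ (λ s v → (s · bienum G) ⊕+ v) t≡1 (totalWeight≡0⇒combination≡0 ws≥0 rest≡0)) ⟩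
        (t · bienum G) ⊕+ combination ws     ≡⟨ ws↦p ⟩
        p                                    ∎)
        where
          rest≡0 : totalWeight ws ≡ 0ℚ
          rest≡0 = trans rest≡1-t (trans (cong (λ s → 1ℚ ℚ.- s) t≡1) (ℚP.+-inverseʳ 1ℚ))
      by-first-weight (no t≢0) (no t≢1) =
        G , proj₁ (extreme (bienum G) y t (inConv-bienum G) y∈ (≤∧≢⇒< t≥0 (t≢0 ∘ sym)) t<1
                     (trans (sym ws↦p) (cong ((t · bienum G) ⊕+_) ws↦y)))
        where
          t<1 : t ℚ.< 1ℚ
          t<1 = ≤∧≢⇒< (0≤-⇒≤ (subst (0ℚ ℚ.≤_) rest≡1-t (totalWeight-nonNeg ws≥0))) t≢1
          normalized : Σ (Point n) λ y → InConv n y × combination ws ≡ (1ℚ ℚ.- t) · y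
          normalized = normalize-weights (<⇒0<1- t<1) ws≥0 rest≡1-t
          y : Point n
          y = proj₁ normalized
          y∈ : InConv n y
          y∈ = proj₁ (proj₂ normalized)
          ws↦y : combination ws ≡ (1ℚ ℚ.- t) · y
          ws↦y = proj₂ (proj₂ normalized)

vertex⇒bienum : ∀ {n p} → IsVertex n p → ∃ λ G → bienum G ≡ p
vertex⇒bienum ((ws , ws≥0 , ws≡1 , ws↦p) , extreme) = extreme⇒bienum extreme ws ws≥0 ws≡1 ws↦p

deg₁ deg₂ common : ∀ {n} → Subgraph n → ℕ
deg₁ G   = degL G F.zero
deg₂ G   = degL G (F.suc F.zero)
common G = Σfin (λ v → b2n (G F.zero v ∧ G (F.suc F.zero) v))

Σfin-cong : ∀ {m} {f g : Fin m → ℕ} → (∀ v → f v ≡ g v) → Σfin f ≡ Σfin g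
Σfin-cong {zero}  h = refl
Σfin-cong {suc m} h = cong₂ _+_ (h F.zero) (Σfin-cong (h ∘ F.suc))

Σfin-+ : ∀ {m} (f g : Fin m → ℕ) → Σfin (λ v → f v + g v) ≡ Σfin f + Σfin g
Σfin-+ {zero}  f g = refl
Σfin-+ {suc m} f g =
  trans (cong (f F.zero + g F.zero +_) (Σfin-+ (f ∘ F.suc) (g ∘ F.suc)))
        (interchange (f F.zero) (g F.zero) (Σfin (f ∘ F.suc)) (Σfin (g ∘ F.suc)))
  where
    interchange : ∀ a b c d → a + b + (c + d) ≡ a + c + (b + d)
    interchange = solve-∀

Σfin-1 : ∀ m → Σfin {m} (λ _ → 1) ≡ m
Σfin-1 zero    = refl
Σfin-1 (suc m) = cong suc (Σfin-1 m)

Σfin-mono-≤ : ∀ {m} {f g : Fin m → ℕ} → (∀ v → f v ≤ g v) → Σfin f ≤ Σfin g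
Σfin-mono-≤ {zero}  h = z≤n
Σfin-mono-≤ {suc m} h = ℕP.+-mono-≤ (h F.zero) (Σfin-mono-≤ (h ∘ F.suc))

-- For one right vertex with edges x, y to u₁, u₂; summed over all right vertices they give c₀, c₁, c₂.
degR≡0-count : ∀ x y → b2n (b2n x + (b2n y + 0) ≡ᵇ 0) + (b2n x + b2n y) ≡ 1 + b2n (x ∧ y)
degR≡0-count true  true  = refl
degR≡0-count true  false = refl
degR≡0-count false true  = refl
degR≡0-count false false = refl

degR≡1-count : ∀ x y → b2n (b2n x + (b2n y + 0) ≡ᵇ 1) + (b2n (x ∧ y) + b2n (x ∧ y)) ≡ b2n x + b2n y
degR≡1-count true  true  = refl
degR≡1-count true  false = refl
degR≡1-count false true  = refl
degR≡1-count false false = refl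

degR≡2-count : ∀ x y → b2n (b2n x + (b2n y + 0) ≡ᵇ 2) ≡ b2n (x ∧ y)
degR≡2-count true  true  = refl
degR≡2-count true  false = refl
degR≡2-count false true  = refl
degR≡2-count false false = refl

b2n-∧≤ˡ : ∀ x y → b2n (x ∧ y) ≤ b2n x
b2n-∧≤ˡ true  true  = ℕP.≤-refl
b2n-∧≤ˡ true  false = z≤n
b2n-∧≤ˡ false y     = z≤n

b2n-∧≤ʳ : ∀ x y → b2n (x ∧ y) ≤ b2n y
b2n-∧≤ʳ x y = subst (_≤ b2n y) (cong b2n (Data.Bool.Properties.∧-comm y x)) (b2n-∧≤ˡ y x)

-- the triples (deg u₁, deg u₂, number of common neighbours) that occur
Realizable : ℕ → ℕ → ℕ → ℕ → Set
Realizable n a b k = k ≤ a × k ≤ b × a + b ≤ n + k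

module _ {n : ℕ} (G : Subgraph n) where
  private
    x y : Fin n → Bool
    x v = G F.zero v
    y v = G (F.suc F.zero) v
    X Y K : Fin n → ℕ
    X v = b2n (x v)
    Y v = b2n (y v)
    K v = b2n (x v ∧ y v)

  c₀+degrees : cG G F.zero + (deg₁ G + deg₂ G) ≡ n + common G
  c₀+degrees = begin
      cG G F.zero + (deg₁ G + deg₂ G)                 ≡⟨ cong (cG G F.zero +_) (sym (Σfin-+ X Y)) ⟩
      cG G F.zero + Σfin (λ v → X v + Y v)           ≡⟨ sym (Σfin-+ _ (λ v → X v + Y v)) ⟩
      Σfin (λ v → b2n (degR G v ≡ᵇ 0) + (X v + Y v)) ≡⟨ Σfin-cong (λ v → degR≡0-count (x v) (y v)) ⟩
      Σfin (λ v → 1 + K v)                           ≡⟨ Σfin-+ (λ _ → 1) K ⟩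
      Σfin {n} (λ _ → 1) + common G                  ≡⟨ cong (_+ common G) (Σfin-1 n) ⟩
      n + common G                                   ∎
    where open ≡-Reasoning

  c₁+commons : cG G (F.suc F.zero) + (common G + common G) ≡ deg₁ G + deg₂ G
  c₁+commons = begin
      cG G (F.suc F.zero) + (common G + common G)       ≡⟨ cong (cG G (F.suc F.zero) +_) (sym (Σfin-+ K K)) ⟩
      cG G (F.suc F.zero) + Σfin (λ v → K v + K v)      ≡⟨ sym (Σfin-+ _ (λ v → K v + K v)) ⟩
      Σfin (λ v → b2n (degR G v ≡ᵇ 1) + (K v + K v))    ≡⟨ Σfin-cong (λ v → degR≡1-count (x v) (y v)) ⟩
      Σfin (λ v → X v + Y v)                            ≡⟨ Σfin-+ X Y ⟩
      deg₁ G + deg₂ G                                   ∎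
    where open ≡-Reasoning

  c₂≡common : cG G (F.suc (F.suc F.zero)) ≡ common G
  c₂≡common = Σfin-cong (λ v → degR≡2-count (x v) (y v))

  realizable : Realizable n (deg₁ G) (deg₂ G) (common G)
  realizable = Σfin-mono-≤ (λ v → b2n-∧≤ˡ (x v) (y v))
             , Σfin-mono-≤ (λ v → b2n-∧≤ʳ (x v) (y v))
             , subst (deg₁ G + deg₂ G ≤_) c₀+degrees (ℕP.m≤n+m _ (cG G F.zero))

bit : Bool → ℚ
bit b = if b then 1ℚ else 0ℚ

δ : ℕ → ℕ → ℚ
δ x a = bit (x ≡ᵇ a)

δ-refl : ∀ x → δ x x ≡ 1ℚ
δ-refl x with x ≡ᵇ x | ℕP.≡⇒≡ᵇ x x refl
... | true | _ = refl

δ-≢ : ∀ {x a} → x ≢ a → δ x a ≡ 0ℚ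
δ-≢ {x} {a} x≢a with x ≡ᵇ a in eq
... | true  = ⊥-elim (x≢a (ℕP.≡ᵇ⇒≡ x a (subst T (sym eq) tt)))
... | false = refl

-- the c-part (n - s + k, s - 2k, k) of b_n(i,j,k), as a function of s = i + j
cpart : ℚ → ℚ → ℚ → Fin 3 → ℚ
cpart N S K F.zero                 = N ℚ.- S ℚ.+ K
cpart N S K (F.suc F.zero)         = S ℚ.- (K ℚ.+ K)
cpart N S K (F.suc (F.suc F.zero)) = K

cpart-mix : ∀ t N S S' K K' r → t ℚ.* cpart N S K r ℚ.+ (1ℚ ℚ.- t) ℚ.* cpart N S' K' r
                              ≡ cpart N (t ℚ.* S ℚ.+ (1ℚ ℚ.- t) ℚ.* S') (t ℚ.* K ℚ.+ (1ℚ ℚ.- t) ℚ.* K') r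
cpart-mix t N S S' K K' F.zero = solve 6 (λ t N S S' K K' →
  t :* (N :- S :+ K) :+ (con 1ℚ :- t) :* (N :- S' :+ K')
  := N :- (t :* S :+ (con 1ℚ :- t) :* S') :+ (t :* K :+ (con 1ℚ :- t) :* K')) refl t N S S' K K'
cpart-mix t N S S' K K' (F.suc F.zero) = solve 5 (λ t S S' K K' →
  t :* (S :- (K :+ K)) :+ (con 1ℚ :- t) :* (S' :- (K' :+ K'))
  := (t :* S :+ (con 1ℚ :- t) :* S') :- ((t :* K :+ (con 1ℚ :- t) :* K') :+ (t :* K :+ (con 1ℚ :- t) :* K'))) refl t S S' K K'
cpart-mix t N S S' K K' (F.suc (F.suc F.zero)) = refl

record Shape {n} (x : Point n) (A : ℕ → ℚ) (S K : ℚ) : Set where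
  constructor shape
  field
    a-part : ∀ r → coord x (inj₁ r) ≡ A (toℕ r)
    c-part : ∀ r → coord x (inj₂ r) ≡ cpart (ℕtoℚ n) S K r
open Shape

shape-mix : ∀ {n} {x y : Point n} {A A' S S' K K'} t → Shape x A S K → Shape y A' S' K'
          → Shape (mix t x y) (λ i → t ℚ.* A i ℚ.+ (1ℚ ℚ.- t) ℚ.* A' i)
                  (t ℚ.* S ℚ.+ (1ℚ ℚ.- t) ℚ.* S') (t ℚ.* K ℚ.+ (1ℚ ℚ.- t) ℚ.* K')
shape-mix {n} {x} {y} {S = S} {S'} {K} {K'} t (shape xa xc) (shape ya yc) = shape
    (λ r → trans (coord-mix t x y (inj₁ r)) (cong₂ (λ u v → t ℚ.* u ℚ.+ (1ℚ ℚ.- t) ℚ.* v) (xa r) (ya r)))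
    (λ r → trans (coord-mix t x y (inj₂ r))
       (trans (cong₂ (λ u v → t ℚ.* u ℚ.+ (1ℚ ℚ.- t) ℚ.* v) (xc r) (yc r)) (cpart-mix t (ℕtoℚ n) S S' K K' r)))

shape-unique : ∀ {n} {x y : Point n} {A A' S S' K K'} → Shape x A S K → Shape y A' S' K'
             → (∀ i → A i ≡ A' i) → S ≡ S' → K ≡ K' → x ≡ y
shape-unique (shape xa xc) (shape ya yc) A≡ refl refl = coord-injective λ
  { (inj₁ r) → trans (xa r) (trans (A≡ _) (sym (ya r)))
  ; (inj₂ r) → trans (xc r) (sym (yc r)) }

bn-shape : ∀ n a b k → Shape (bn n a b k) (λ i → δ i a ℚ.+ δ i b) (ℕtoℚ (a + b)) (ℕtoℚ k)
bn-shape n a b k = shape apart cpart-bn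
  where
    unit-δ : ∀ c r → V.lookup (unit n c) r ≡ δ (toℕ r) c
    unit-δ c r = VP.lookup∘tabulate (λ r → δ (toℕ r) c) r
    apart : ∀ r → coord (bn n a b k) (inj₁ r) ≡ δ (toℕ r) a ℚ.+ δ (toℕ r) b
    apart r = trans (VP.lookup-zipWith ℚ._+_ r (unit n a) (unit n b)) (cong₂ ℚ._+_ (unit-δ a r) (unit-δ b r))
    cpart-bn : ∀ r → coord (bn n a b k) (inj₂ r) ≡ cpart (ℕtoℚ n) (ℕtoℚ (a + b)) (ℕtoℚ k) r
    cpart-bn F.zero = trans (ℤtoℚ-+ (ℤ.+ n ℤ.- ℤ.+ (a + b)) (ℤ.+ k))
                            (cong (ℚ._+ ℕtoℚ k) (ℤtoℚ-- (ℤ.+ n) (ℤ.+ (a + b))))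
    cpart-bn (F.suc F.zero) = trans (ℤtoℚ-- (ℤ.+ (a + b)) (ℤ.+ (2 * k)))
      (cong (λ z → ℕtoℚ (a + b) ℚ.- z) (trans (cong ℕtoℚ (cong (k +_) (ℕP.+-identityʳ k))) (ℕtoℚ-+ k k)))
    cpart-bn (F.suc (F.suc F.zero)) = refl

c₀-bn : ∀ n a b k → a + b ≤ n + k → coord (bn n a b k) (inj₂ F.zero) ≡ ℕtoℚ (n + k ∸ (a + b))
c₀-bn n a b k feasible = begin
    coord (bn n a b k) (inj₂ F.zero)            ≡⟨ c-part (bn-shape n a b k) F.zero ⟩
    ℕtoℚ n ℚ.- ℕtoℚ (a + b) ℚ.+ ℕtoℚ k         ≡⟨ solve 3 (λ N S K → N :- S :+ K := (N :+ K) :- S) refl (ℕtoℚ n) _ _ ⟩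
    (ℕtoℚ n ℚ.+ ℕtoℚ k) ℚ.- ℕtoℚ (a + b)       ≡⟨ cong (ℚ._- ℕtoℚ (a + b)) (sym (ℕtoℚ-+ n k)) ⟩
    ℕtoℚ (n + k) ℚ.- ℕtoℚ (a + b)              ≡⟨ sym (ℕtoℚ-∸ feasible) ⟩
    ℕtoℚ (n + k ∸ (a + b))                      ∎
  where open ≡-Reasoning

c₁-bn : ∀ n a b k → k + k ≤ a + b → coord (bn n a b k) (inj₂ (F.suc F.zero)) ≡ ℕtoℚ (a + b ∸ (k + k))
c₁-bn n a b k 2k≤s = trans (c-part (bn-shape n a b k) (F.suc F.zero))
  (trans (cong (λ z → ℕtoℚ (a + b) ℚ.- z) (sym (ℕtoℚ-+ k k))) (sym (ℕtoℚ-∸ 2k≤s)))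

bn-swap : ∀ n a b k → bn n a b k ≡ bn n b a k
bn-swap n a b k = shape-unique (bn-shape n a b k) (bn-shape n b a k)
  (λ i → ℚP.+-comm (δ i a) (δ i b)) (cong ℕtoℚ (ℕP.+-comm a b)) refl

bn-cong : ∀ {n a a' b b' k k'} → a ≡ a' → b ≡ b' → k ≡ k' → bn n a b k ≡ bn n a' b' k'
bn-cong refl refl refl = refl

private
  ≡ᵇ-sym : ∀ a b → (a ≡ᵇ b) ≡ (b ≡ᵇ a)
  ≡ᵇ-sym zero    zero    = refl
  ≡ᵇ-sym zero    (suc b) = refl
  ≡ᵇ-sym (suc a) zero    = refl
  ≡ᵇ-sym (suc a) (suc b) = ≡ᵇ-sym a b

  ℕtoℚ-b2n+b2n : ∀ x y → ℕtoℚ (b2n x + (b2n y + 0)) ≡ bit x ℚ.+ bit y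
  ℕtoℚ-b2n+b2n true  true  = refl
  ℕtoℚ-b2n+b2n true  false = refl
  ℕtoℚ-b2n+b2n false true  = refl
  ℕtoℚ-b2n+b2n false false = refl

  +≡⇒≡- : ∀ {a d m} → a ℚ.+ d ≡ m → a ≡ m ℚ.- d
  +≡⇒≡- {a} {d} e = trans (solve 2 (λ a d → a := (a :+ d) :- d) refl a d) (cong (ℚ._- d) e)

bienum-shape : ∀ {n} (G : Subgraph n)
             → Shape (bienum G) (λ i → δ i (deg₁ G) ℚ.+ δ i (deg₂ G)) (ℕtoℚ (deg₁ G + deg₂ G)) (ℕtoℚ (common G))
bienum-shape {n} G = shape apart cpart-G
  where
    apart : ∀ r → coord (bienum G) (inj₁ r) ≡ δ (toℕ r) (deg₁ G) ℚ.+ δ (toℕ r) (deg₂ G)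
    apart r = trans (VP.lookup∘tabulate (λ k → ℕtoℚ (aG G k)) r)
      (trans (ℕtoℚ-b2n+b2n (deg₁ G ≡ᵇ toℕ r) (deg₂ G ≡ᵇ toℕ r))
        (cong₂ (λ x y → bit x ℚ.+ bit y) (≡ᵇ-sym (deg₁ G) (toℕ r)) (≡ᵇ-sym (deg₂ G) (toℕ r))))
    N D C : ℚ
    N = ℕtoℚ n
    D = ℕtoℚ (deg₁ G + deg₂ G)
    C = ℕtoℚ (common G)
    c : Fin 3 → ℚ
    c k = ℕtoℚ (cG G k)
    lookup-c : ∀ k → coord (bienum G) (inj₂ k) ≡ c k
    lookup-c = VP.lookup∘tabulate c
    cpart-G : ∀ r → coord (bienum G) (inj₂ r) ≡ cpart N D C r
    cpart-G F.zero = trans (lookup-c F.zero) (trans (+≡⇒≡- c₀+D≡) (solve 3 (λ N C D → (N :+ C) :- D := N :- D :+ C) refl N C D))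
      where
        c₀+D≡ : c F.zero ℚ.+ D ≡ N ℚ.+ C
        c₀+D≡ = trans (sym (ℕtoℚ-+ (cG G F.zero) _)) (trans (cong ℕtoℚ (c₀+degrees G)) (ℕtoℚ-+ n (common G)))
    cpart-G (F.suc F.zero) = trans (lookup-c (F.suc F.zero)) (+≡⇒≡- c₁+2C≡)
      where
        c₁+2C≡ : c (F.suc F.zero) ℚ.+ (C ℚ.+ C) ≡ D
        c₁+2C≡ = trans (cong (c (F.suc F.zero) ℚ.+_) (sym (ℕtoℚ-+ (common G) (common G))))
                       (trans (sym (ℕtoℚ-+ (cG G (F.suc F.zero)) _)) (cong ℕtoℚ (c₁+commons G)))
    cpart-G (F.suc (F.suc F.zero)) = trans (lookup-c (F.suc (F.suc F.zero))) (cong ℕtoℚ (c₂≡common G))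

bienum≡bn : ∀ {n} (G : Subgraph n) → bienum G ≡ bn n (deg₁ G) (deg₂ G) (common G)
bienum≡bn {n} G = shape-unique (bienum-shape G) (bn-shape n (deg₁ G) (deg₂ G) (common G)) (λ _ → refl) refl refl

extend : ∀ {n} → Bool → Bool → Subgraph n → Subgraph (suc n)
extend x y G F.zero             F.zero    = x
extend x y G (F.suc F.zero)     F.zero    = y
extend x y G u                  (F.suc v) = G u v

realizable⇒subgraph : ∀ n a b k → Realizable n a b k
                    → Σ (Subgraph n) λ G → deg₁ G ≡ a × deg₂ G ≡ b × common G ≡ k
realizable⇒subgraph zero a b k (k≤a , k≤b , a+b≤k) = (λ _ ()) , sym a≡0 , sym b≡0 , sym k≡0
  where
    a≡0 : a ≡ 0
    a≡0 = ℕP.n≤0⇒n≡0 (ℕP.+-cancelʳ-≤ b a 0 (ℕP.≤-trans a+b≤k k≤b))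
    b≡0 : b ≡ 0
    b≡0 = ℕP.n≤0⇒n≡0 (ℕP.+-cancelˡ-≤ a b 0 (subst (a + b ≤_) (sym (ℕP.+-identityʳ a)) (ℕP.≤-trans a+b≤k k≤a)))
    k≡0 : k ≡ 0
    k≡0 = ℕP.n≤0⇒n≡0 (subst (k ≤_) a≡0 k≤a)
realizable⇒subgraph (suc n) (suc a) (suc b) (suc k) (s≤s k≤a , s≤s k≤b , feasible)
  with realizable⇒subgraph n a b k (k≤a , k≤b , feasible′)
  where feasible′ = ℕP.+-cancelˡ-≤ 1 (a + b) (n + k)
                      (subst₂ _≤_ (ℕP.+-suc a b) (ℕP.+-suc n k) (s≤s⁻¹ feasible))
... | G , d₁≡a , d₂≡b , c≡k = extend true true G , cong suc d₁≡a , cong suc d₂≡b , cong suc c≡k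
realizable⇒subgraph (suc n) (suc a) b zero (_ , _ , feasible)
  with realizable⇒subgraph n a b zero (z≤n , z≤n , s≤s⁻¹ feasible)
... | G , d₁≡a , d₂≡b , c≡k = extend true false G , cong suc d₁≡a , d₂≡b , c≡k
realizable⇒subgraph (suc n) zero (suc b) zero (_ , _ , feasible)
  with realizable⇒subgraph n zero b zero (z≤n , z≤n , s≤s⁻¹ feasible)
... | G , d₁≡a , d₂≡b , c≡k = extend false true G , d₁≡a , cong suc d₂≡b , c≡k
realizable⇒subgraph (suc n) zero zero zero _
  with realizable⇒subgraph n zero zero zero (z≤n , z≤n , z≤n)
... | G , d₁≡a , d₂≡b , c≡k = extend false false G , d₁≡a , d₂≡b , c≡k

inConv-bn : ∀ {n a b k} → Realizable n a b k → InConv n (bn n a b k)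
inConv-bn {n} {a} {b} {k} r with realizable⇒subgraph n a b k r
... | G , d₁≡a , d₂≡b , c≡k = subst (InConv n) (trans (bienum≡bn G) (bn-cong d₁≡a d₂≡b c≡k)) (inConv-bienum G)

coordinate : ∀ {n} → Coord n → Linear n
coordinate r = record { φ = λ p → coord p r ; φ-⊕+ = λ x y → coord-⊕+ x y r ; φ-· = λ t x → coord-· t x r }

-ᴸ_ : ∀ {n} → Linear n → Linear n
-ᴸ L = record
  { φ   = λ p → ℚ.- φ p
  ; φ-⊕+ = λ x y → trans (cong ℚ.-_ (φ-⊕+ x y)) (ℚP.neg-distrib-+ (φ x) (φ y))
  ; φ-·  = λ t x → trans (cong ℚ.-_ (φ-· t x)) (ℚP.neg-distribʳ-* t (φ x))
  }
  where open Linear L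

_+ᴸ_ : ∀ {n} → Linear n → Linear n → Linear n
L₁ +ᴸ L₂ = record
  { φ   = λ p → φ₁ p ℚ.+ φ₂ p
  ; φ-⊕+ = λ x y → trans (cong₂ ℚ._+_ (φ₁-⊕+ x y) (φ₂-⊕+ x y))
                         (solve 4 (λ a b c d → (a :+ b) :+ (c :+ d) := (a :+ c) :+ (b :+ d)) refl (φ₁ x) (φ₁ y) (φ₂ x) (φ₂ y))
  ; φ-·  = λ t x → trans (cong₂ ℚ._+_ (φ₁-· t x) (φ₂-· t x)) (sym (ℚP.*-distribˡ-+ t (φ₁ x) (φ₂ x)))
  }
  where
    open Linear L₁ renaming (φ to φ₁; φ-⊕+ to φ₁-⊕+; φ-· to φ₁-·)
    open Linear L₂ renaming (φ to φ₂; φ-⊕+ to φ₂-⊕+; φ-· to φ₂-·)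

φ-bienum : ∀ {n} (L : Linear n) (G : Subgraph n) → Linear.φ L (bienum G) ≡ Linear.φ L (bn n (deg₁ G) (deg₂ G) (common G))
φ-bienum L G = cong (Linear.φ L) (bienum≡bn G)

degree-coordinate : ∀ {n i} → i ≤ n → Linear n
degree-coordinate i≤n = coordinate (inj₁ (F.fromℕ< (s≤s i≤n)))

degree-coordinate-bn : ∀ {n i} (i≤n : i ≤ n) a b k → Linear.φ (degree-coordinate i≤n) (bn n a b k) ≡ δ i a ℚ.+ δ i b
degree-coordinate-bn {n} i≤n a b k = trans (a-part (bn-shape n a b k) (F.fromℕ< (s≤s i≤n)))
  (cong (λ x → δ x a ℚ.+ δ x b) (FP.toℕ-fromℕ< (s≤s i≤n)))

c₂-coordinate : ∀ {n} → Linear n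
c₂-coordinate = coordinate (inj₂ (F.suc (F.suc F.zero)))

c₂-bienum : ∀ {n} (G : Subgraph n) → Linear.φ c₂-coordinate (bienum G) ≡ ℕtoℚ (common G)
c₂-bienum G = φ-bienum c₂-coordinate G

-- Diagonal vertices

two : ℚ
two = 1ℚ ℚ.+ 1ℚ

bit+bit≤2 : ∀ p q → bit p ℚ.+ bit q ℚ.≤ two
bit+bit≤2 p q = ℚP.+-mono-≤ (bit≤1 p) (bit≤1 q)
  where
    bit≤1 : ∀ b → bit b ℚ.≤ 1ℚ
    bit≤1 true  = ℚP.≤-refl
    bit≤1 false = ℚP.≤ᵇ⇒≤ tt

bit+bit≡2 : ∀ p q → bit p ℚ.+ bit q ≡ two → T p × T q
bit+bit≡2 true  true  _ = tt , tt
bit+bit≡2 true  false ()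
bit+bit≡2 false true  ()
bit+bit≡2 false false ()

2*≡+ : ∀ a → 2 * a ≡ a + a
2*≡+ a = cong (a +_) (ℕP.+-identityʳ a)

diagonal-bottom-realizable : ∀ {n a} → a ≤ n → Realizable n a a (2 * a ∸ n)
diagonal-bottom-realizable {n} {a} a≤n = L≤a , L≤a , subst (_≤ n + (2 * a ∸ n)) (2*≡+ a) (ℕP.m≤n+m∸n (2 * a) n)
  where
    L≤a : 2 * a ∸ n ≤ a
    L≤a = ℕP.m≤n+o⇒m∸n≤o (2 * a) n (subst (_≤ n + a) (sym (2*≡+ a)) (ℕP.+-monoˡ-≤ a a≤n))

module _ {n i : ℕ} (i≤n : i ≤ n) where
  private
    open Linear
    aᵢ : Linear n
    aᵢ = degree-coordinate i≤n

    aᵢ-bienum : ∀ G → φ aᵢ (bienum G) ≡ δ i (deg₁ G) ℚ.+ δ i (deg₂ G)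
    aᵢ-bienum G = trans (φ-bienum aᵢ G) (degree-coordinate-bn i≤n (deg₁ G) (deg₂ G) (common G))

    aᵢ≤2 : ∀ G → ⊤ → φ aᵢ (bienum G) ℚ.≤ two
    aᵢ≤2 G _ = subst (ℚ._≤ two) (sym (aᵢ-bienum G)) (bit+bit≤2 (i ≡ᵇ deg₁ G) (i ≡ᵇ deg₂ G))

    degrees : ∀ {G} → OnFace (λ _ → ⊤) aᵢ two G → deg₁ G ≡ i × deg₂ G ≡ i
    degrees {G} (face _ aᵢ≡2) = sym (ℕP.≡ᵇ⇒≡ i (deg₁ G) (proj₁ bits)) , sym (ℕP.≡ᵇ⇒≡ i (deg₂ G) (proj₂ bits))
      where
        bits : T (i ≡ᵇ deg₁ G) × T (i ≡ᵇ deg₂ G)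
        bits = bit+bit≡2 (i ≡ᵇ deg₁ G) (i ≡ᵇ deg₂ G) (trans (sym (aᵢ-bienum G)) aᵢ≡2)

    aᵢ-diagonal : ∀ k → φ aᵢ (bn n i i k) ≡ two
    aᵢ-diagonal k = trans (degree-coordinate-bn i≤n i i k) (cong₂ ℚ._+_ (δ-refl i) (δ-refl i))

  diagonal-top-vertex : IsVertex n (bn n i i i)
  diagonal-top-vertex =
    vertex-intro (inConv-bn (ℕP.≤-refl , ℕP.≤-refl , ℕP.+-monoˡ-≤ i i≤n))
      (extremeOn-face aᵢ two aᵢ≤2 (aᵢ-diagonal i)
        (extremeOn-face c₂-coordinate (ℕtoℚ i) c₂≤i refl
          (extremeOn-singleton only)))
    where
      c₂≤i : ∀ G → OnFace (λ _ → ⊤) aᵢ two G → φ c₂-coordinate (bienum G) ℚ.≤ ℕtoℚ i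
      c₂≤i G onFace = subst (ℚ._≤ ℕtoℚ i) (sym (c₂-bienum G))
        (ℕtoℚ-mono-≤ (subst (common G ≤_) (proj₁ (degrees onFace)) (proj₁ (realizable G))))
      only : ∀ G → OnFace (OnFace (λ _ → ⊤) aᵢ two) c₂-coordinate (ℕtoℚ i) G → bienum G ≡ bn n i i i
      only G (face onFace c₂≡i) = trans (bienum≡bn G)
        (bn-cong (proj₁ (degrees onFace)) (proj₂ (degrees onFace)) (ℕtoℚ-injective (trans (sym (c₂-bienum G)) c₂≡i)))

  diagonal-bottom-vertex : IsVertex n (bn n i i (2 * i ∸ n))
  diagonal-bottom-vertex =
    vertex-intro (inConv-bn (diagonal-bottom-realizable i≤n))
      (extremeOn-face aᵢ two aᵢ≤2 (aᵢ-diagonal L)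
        (extremeOn-face (-ᴸ c₂-coordinate) (ℚ.- ℕtoℚ L) -c₂≤-L refl
          (extremeOn-singleton only)))
    where
      L : ℕ
      L = 2 * i ∸ n
      -c₂≤-L : ∀ G → OnFace (λ _ → ⊤) aᵢ two G → φ (-ᴸ c₂-coordinate) (bienum G) ℚ.≤ ℚ.- ℕtoℚ L
      -c₂≤-L G onFace = subst (ℚ._≤ ℚ.- ℕtoℚ L) (sym (cong ℚ.-_ (c₂-bienum G)))
        (ℚP.neg-antimono-≤ (ℕtoℚ-mono-≤ (ℕP.m≤n+o⇒m∸n≤o (2 * i) n
          (subst (_≤ n + common G) (trans (cong₂ _+_ (proj₁ (degrees onFace)) (proj₂ (degrees onFace))) (sym (2*≡+ i)))
                 (proj₂ (proj₂ (realizable G)))))))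
      only : ∀ G → OnFace (OnFace (λ _ → ⊤) aᵢ two) (-ᴸ c₂-coordinate) (ℚ.- ℕtoℚ L) G → bienum G ≡ bn n i i L
      only G (face onFace -c₂≡-L) = trans (bienum≡bn G)
        (bn-cong (proj₁ (degrees onFace)) (proj₂ (degrees onFace))
          (ℕtoℚ-injective (ℚP.neg-injective (trans (sym (cong ℚ.-_ (c₂-bienum G))) -c₂≡-L))))

-- Off-diagonal vertices

Exclusive : Bool → Bool → Set
Exclusive p q = T p → T q → ⊥

bits≤2 : ∀ p₁ p₂ q₁ q₂ → Exclusive p₁ q₁ → Exclusive p₂ q₂ → (bit p₁ ℚ.+ bit p₂) ℚ.+ (bit q₁ ℚ.+ bit q₂) ℚ.≤ two
bits≤2 true  _     true  _     e₁ e₂ = ⊥-elim (e₁ tt tt)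
bits≤2 _     true  _     true  e₁ e₂ = ⊥-elim (e₂ tt tt)
bits≤2 true  true  false false _ _ = ℚP.≤ᵇ⇒≤ tt
bits≤2 true  false false true  _ _ = ℚP.≤ᵇ⇒≤ tt
bits≤2 true  false false false _ _ = ℚP.≤ᵇ⇒≤ tt
bits≤2 false true  true  false _ _ = ℚP.≤ᵇ⇒≤ tt
bits≤2 false true  false false _ _ = ℚP.≤ᵇ⇒≤ tt
bits≤2 false false true  true  _ _ = ℚP.≤ᵇ⇒≤ tt
bits≤2 false false true  false _ _ = ℚP.≤ᵇ⇒≤ tt
bits≤2 false false false true  _ _ = ℚP.≤ᵇ⇒≤ tt
bits≤2 false false false false _ _ = ℚP.≤ᵇ⇒≤ tt

bits≡2 : ∀ p₁ p₂ q₁ q₂ → Exclusive p₁ q₁ → Exclusive p₂ q₂ → (bit p₁ ℚ.+ bit p₂) ℚ.+ (bit q₁ ℚ.+ bit q₂) ≡ two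
       → (T p₁ ⊎ T q₁) × (T p₂ ⊎ T q₂)
bits≡2 true  _     true  _     e₁ e₂ _ = ⊥-elim (e₁ tt tt)
bits≡2 _     true  _     true  e₁ e₂ _ = ⊥-elim (e₂ tt tt)
bits≡2 true  true  false false _ _ _ = inj₁ tt , inj₁ tt
bits≡2 true  false false true  _ _ _ = inj₁ tt , inj₂ tt
bits≡2 false true  true  false _ _ _ = inj₂ tt , inj₁ tt
bits≡2 false false true  true  _ _ _ = inj₂ tt , inj₂ tt
bits≡2 true  false false false _ _ ()
bits≡2 false true  false false _ _ ()
bits≡2 false false true  false _ _ ()
bits≡2 false false false true  _ _ ()
bits≡2 false false false false _ _ ()

2i<n<2j⇒i<j : ∀ {n i j} → suc (i + i) ≤ n → suc n ≤ j + j → i < j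
2i<n<2j⇒i<j 2i<n n<2j = ℕP.≰⇒> λ j≤i → ℕP.<-irrefl refl (ℕP.<-≤-trans (ℕP.<-trans 2i<n n<2j) (ℕP.+-mono-≤ j≤i j≤i))

IsPair : ℕ → ℕ → ℕ → ℕ → Set
IsPair i j a b = (a ≡ i × b ≡ j) ⊎ (a ≡ j × b ≡ i)

module _ {n i j : ℕ} (2i<n : suc (i + i) ≤ n) (n<2j : suc n ≤ j + j) where
  private
    i<j : i < j
    i<j = 2i<n<2j⇒i<j 2i<n n<2j

  degree-sum-bound : ∀ {a b} → a ≡ i ⊎ a ≡ j → b ≡ i ⊎ b ≡ j → a + b ≤ n
                   → a + b ≤ i + j × (a + b ≡ i + j → IsPair i j a b)
  degree-sum-bound (inj₁ refl) (inj₁ refl) _ =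
    ℕP.+-monoʳ-≤ i (ℕP.<⇒≤ i<j) , λ 2i≡i+j → ⊥-elim (ℕP.<⇒≢ i<j (ℕP.+-cancelˡ-≡ i i j 2i≡i+j))
  degree-sum-bound (inj₁ refl) (inj₂ refl) _ = ℕP.≤-refl , λ _ → inj₁ (refl , refl)
  degree-sum-bound (inj₂ refl) (inj₁ refl) _ = ℕP.≤-reflexive (ℕP.+-comm j i) , λ _ → inj₂ (refl , refl)
  degree-sum-bound (inj₂ refl) (inj₂ refl) 2j≤n = ⊥-elim (ℕP.<-irrefl refl (ℕP.<-≤-trans n<2j 2j≤n))

  -- among degree pairs from {i, j} with a + b = n + c, the coordinate c₁ = a + b - 2c is maximal exactly at {i, j}
  c₁-bound : n < i + j → j ≤ n → ∀ {a b c} → a ≡ i ⊎ a ≡ j → b ≡ i ⊎ b ≡ j → a + b ≡ n + c → c ≤ a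
           → a + b ∸ (c + c) ≤ i + j ∸ ((i + j ∸ n) + (i + j ∸ n))
           × (a + b ∸ (c + c) ≡ i + j ∸ ((i + j ∸ n) + (i + j ∸ n)) → IsPair i j a b × c ≡ i + j ∸ n)
  c₁-bound large j≤n {c = c} (inj₁ refl) (inj₁ refl) 2i≡n+c _ =
    ⊥-elim (ℕP.<-irrefl refl (ℕP.<-≤-trans 2i<n (subst (n ≤_) (sym 2i≡n+c) (ℕP.m≤m+n n c))))
  c₁-bound large j≤n {c = c} (inj₁ refl) (inj₂ refl) i+j≡n+c _ =
    ℕP.≤-reflexive (cong (λ l → i + j ∸ (l + l)) c≡L) , λ _ → inj₁ (refl , refl) , c≡L
    where
      c≡L : c ≡ i + j ∸ n
      c≡L = ℕP.+-cancelˡ-≡ n c (i + j ∸ n) (trans (sym i+j≡n+c) (sym (ℕP.m+[n∸m]≡n (ℕP.<⇒≤ large))))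
  c₁-bound large j≤n {c = c} (inj₂ refl) (inj₁ refl) j+i≡n+c _ =
    ℕP.≤-reflexive (cong₂ (λ s l → s ∸ (l + l)) (ℕP.+-comm j i) c≡L) , λ _ → inj₂ (refl , refl) , c≡L
    where
      c≡L : c ≡ i + j ∸ n
      c≡L = ℕP.+-cancelˡ-≡ n c (i + j ∸ n) (trans (sym j+i≡n+c) (trans (ℕP.+-comm j i) (sym (ℕP.m+[n∸m]≡n (ℕP.<⇒≤ large)))))
  c₁-bound large j≤n {c = c} (inj₂ refl) (inj₂ refl) 2j≡n+c c≤j = ℕP.<⇒≤ lt , λ e → ⊥-elim (ℕP.<-irrefl e lt)
    where
      L : ℕ
      L = i + j ∸ n
      n+L≡i+j : n + L ≡ i + j
      n+L≡i+j = ℕP.m+[n∸m]≡n (ℕP.<⇒≤ large)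
      shift : ∀ m c → (m + c) ∸ (c + c) ≡ m ∸ c
      shift m c = trans (cong (_∸ (c + c)) (ℕP.+-comm m c)) (ℕP.[m+n]∸[m+o]≡n∸o c m c)
      L<c : L < c
      L<c = ℕP.+-cancelˡ-< n L c (subst₂ _<_ (sym n+L≡i+j) 2j≡n+c (ℕP.+-monoˡ-< j i<j))
      lt : j + j ∸ (c + c) < i + j ∸ (L + L)
      lt = subst₂ _<_ (sym (trans (cong (_∸ (c + c)) 2j≡n+c) (shift n c)))
                      (sym (trans (cong (_∸ (L + L)) (sym n+L≡i+j)) (shift n L)))
                      (ℕP.∸-monoʳ-< L<c (ℕP.≤-trans c≤j j≤n))

module OffDiagonal {n i j : ℕ} (2i<n : suc (i + i) ≤ n) (n<2j : suc n ≤ j + j) (j≤n : j ≤ n) where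
  private
    open Linear

    L : ℕ
    L = i + j ∸ n

    i≤n : i ≤ n
    i≤n = ℕP.≤-trans (ℕP.m≤m+n i i) (ℕP.≤-trans (ℕP.n≤1+n _) 2i<n)

    i≢j : i ≢ j
    i≢j = ℕP.<⇒≢ (2i<n<2j⇒i<j 2i<n n<2j)

    exclusive : ∀ d → Exclusive (i ≡ᵇ d) (j ≡ᵇ d)
    exclusive d i≡d j≡d = i≢j (trans (ℕP.≡ᵇ⇒≡ i d i≡d) (sym (ℕP.≡ᵇ⇒≡ j d j≡d)))

    aᵢ+aⱼ : Linear n
    aᵢ+aⱼ = degree-coordinate i≤n +ᴸ degree-coordinate j≤n

    aᵢ+aⱼ-bn : ∀ a b k → φ aᵢ+aⱼ (bn n a b k) ≡ (δ i a ℚ.+ δ i b) ℚ.+ (δ j a ℚ.+ δ j b)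
    aᵢ+aⱼ-bn a b k = cong₂ ℚ._+_ (degree-coordinate-bn i≤n a b k) (degree-coordinate-bn j≤n a b k)

    aᵢ+aⱼ-bienum : ∀ G → φ aᵢ+aⱼ (bienum G) ≡ (δ i (deg₁ G) ℚ.+ δ i (deg₂ G)) ℚ.+ (δ j (deg₁ G) ℚ.+ δ j (deg₂ G))
    aᵢ+aⱼ-bienum G = trans (φ-bienum aᵢ+aⱼ G) (aᵢ+aⱼ-bn (deg₁ G) (deg₂ G) (common G))

    aᵢ+aⱼ≤2 : ∀ G → ⊤ → φ aᵢ+aⱼ (bienum G) ℚ.≤ two
    aᵢ+aⱼ≤2 G _ = subst (ℚ._≤ two) (sym (aᵢ+aⱼ-bienum G))
      (bits≤2 (i ≡ᵇ deg₁ G) (i ≡ᵇ deg₂ G) (j ≡ᵇ deg₁ G) (j ≡ᵇ deg₂ G) (exclusive (deg₁ G)) (exclusive (deg₂ G)))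

    Face₁ : Subgraph n → Set
    Face₁ = OnFace (λ _ → ⊤) aᵢ+aⱼ two

    IorJ : ℕ → Set
    IorJ d = d ≡ i ⊎ d ≡ j

    ∈ij : ∀ d → T (i ≡ᵇ d) ⊎ T (j ≡ᵇ d) → IorJ d
    ∈ij d (inj₁ i≡d) = inj₁ (sym (ℕP.≡ᵇ⇒≡ i d i≡d))
    ∈ij d (inj₂ j≡d) = inj₂ (sym (ℕP.≡ᵇ⇒≡ j d j≡d))

    degrees : ∀ {G} → Face₁ G → IorJ (deg₁ G) × IorJ (deg₂ G)
    degrees {G} (face _ φ≡2) = ∈ij (deg₁ G) (proj₁ bits) , ∈ij (deg₂ G) (proj₂ bits)
      where
        bits = bits≡2 (i ≡ᵇ deg₁ G) (i ≡ᵇ deg₂ G) (j ≡ᵇ deg₁ G) (j ≡ᵇ deg₂ G)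
                      (exclusive (deg₁ G)) (exclusive (deg₂ G)) (trans (sym (aᵢ+aⱼ-bienum G)) φ≡2)

    aᵢ+aⱼ-p : φ aᵢ+aⱼ (bn n i j L) ≡ two
    aᵢ+aⱼ-p = trans (aᵢ+aⱼ-bn i j L)
      (cong₂ ℚ._+_ (cong₂ ℚ._+_ (δ-refl i) (δ-≢ i≢j)) (cong₂ ℚ._+_ (δ-≢ (i≢j ∘ sym)) (δ-refl j)))

    bienum≡p : ∀ G → IsPair i j (deg₁ G) (deg₂ G) → common G ≡ L → bienum G ≡ bn n i j L
    bienum≡p G (inj₁ (d₁≡i , d₂≡j)) c≡L = trans (bienum≡bn G) (bn-cong d₁≡i d₂≡j c≡L)
    bienum≡p G (inj₂ (d₁≡j , d₂≡i)) c≡L = trans (bienum≡bn G) (trans (bn-cong d₁≡j d₂≡i c≡L) (bn-swap n j i L))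

    c₁-coordinate : Linear n
    c₁-coordinate = coordinate (inj₂ (F.suc F.zero))

    c₁-bienum : ∀ G → φ c₁-coordinate (bienum G) ≡ ℕtoℚ (deg₁ G + deg₂ G ∸ (common G + common G))
    c₁-bienum G = trans (φ-bienum c₁-coordinate G)
      (c₁-bn n (deg₁ G) (deg₂ G) (common G) (ℕP.+-mono-≤ (proj₁ (realizable G)) (proj₁ (proj₂ (realizable G)))))

    L≤i : L ≤ i
    L≤i = ℕP.m≤n+o⇒m∸n≤o (i + j) n (subst (i + j ≤_) (ℕP.+-comm i n) (ℕP.+-monoʳ-≤ i j≤n))

    L≤j : L ≤ j
    L≤j = ℕP.m≤n+o⇒m∸n≤o (i + j) n (ℕP.+-monoˡ-≤ j i≤n)

    c₁-p : φ c₁-coordinate (bn n i j L) ≡ ℕtoℚ (i + j ∸ (L + L))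
    c₁-p = c₁-bn n i j L (ℕP.+-mono-≤ L≤i L≤j)

    p∈ : InConv n (bn n i j L)
    p∈ = inConv-bn (L≤i , L≤j , ℕP.m≤n+m∸n (i + j) n)

    vertex-if-small : i + j ≤ n → IsVertex n (bn n i j L)
    vertex-if-small small =
      vertex-intro p∈
        (extremeOn-face aᵢ+aⱼ two aᵢ+aⱼ≤2 aᵢ+aⱼ-p
          (extremeOn-face (-ᴸ c₂-coordinate) (ℚ.- ℕtoℚ L) -c₂≤-L refl
            (extremeOn-face c₁-coordinate (ℕtoℚ (i + j ∸ (L + L))) c₁≤ c₁-p
              (extremeOn-singleton only))))
      where
        L≡0 : L ≡ 0
        L≡0 = ℕP.m≤n⇒m∸n≡0 small
        Face₂ : Subgraph n → Set
        Face₂ = OnFace Face₁ (-ᴸ c₂-coordinate) (ℚ.- ℕtoℚ L)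
        -c₂≤-L : ∀ G → Face₁ G → φ (-ᴸ c₂-coordinate) (bienum G) ℚ.≤ ℚ.- ℕtoℚ L
        -c₂≤-L G _ = subst₂ ℚ._≤_ (sym (cong ℚ.-_ (c₂-bienum G))) (cong (λ l → ℚ.- ℕtoℚ l) (sym L≡0))
                            (ℚP.neg-antimono-≤ (ℕtoℚ-mono-≤ {0} {common G} z≤n))
        common≡0 : ∀ {G} → Face₂ G → common G ≡ 0
        common≡0 {G} (face _ -c₂≡-L) =
          trans (ℕtoℚ-injective (ℚP.neg-injective (trans (sym (cong ℚ.-_ (c₂-bienum G))) -c₂≡-L))) L≡0
        degree-sum : ∀ {G} → Face₂ G
                   → deg₁ G + deg₂ G ≤ i + j × (deg₁ G + deg₂ G ≡ i + j → IsPair i j (deg₁ G) (deg₂ G))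
        degree-sum {G} face₂@(face face₁ _) = degree-sum-bound 2i<n n<2j (proj₁ (degrees face₁)) (proj₂ (degrees face₁))
          (subst (deg₁ G + deg₂ G ≤_) (trans (cong (n +_) (common≡0 face₂)) (ℕP.+-identityʳ n)) (proj₂ (proj₂ (realizable G))))
        c₁≡degree-sum : ∀ {G} → Face₂ G → φ c₁-coordinate (bienum G) ≡ ℕtoℚ (deg₁ G + deg₂ G)
        c₁≡degree-sum {G} face₂ = trans (c₁-bienum G) (cong (λ c → ℕtoℚ (deg₁ G + deg₂ G ∸ (c + c))) (common≡0 face₂))
        c₁-p≡ : ℕtoℚ (i + j ∸ (L + L)) ≡ ℕtoℚ (i + j)
        c₁-p≡ = cong (λ l → ℕtoℚ (i + j ∸ (l + l))) L≡0
        c₁≤ : ∀ G → Face₂ G → φ c₁-coordinate (bienum G) ℚ.≤ ℕtoℚ (i + j ∸ (L + L))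
        c₁≤ G face₂ = subst₂ ℚ._≤_ (sym (c₁≡degree-sum face₂)) (sym c₁-p≡) (ℕtoℚ-mono-≤ (proj₁ (degree-sum face₂)))
        only : ∀ G → OnFace Face₂ c₁-coordinate (ℕtoℚ (i + j ∸ (L + L))) G → bienum G ≡ bn n i j L
        only G (face face₂ c₁≡) = bienum≡p G
          (proj₂ (degree-sum face₂) (ℕtoℚ-injective (trans (sym (c₁≡degree-sum face₂)) (trans c₁≡ c₁-p≡))))
          (trans (common≡0 face₂) (sym L≡0))

    vertex-if-large : n < i + j → IsVertex n (bn n i j L)
    vertex-if-large large =
      vertex-intro p∈
        (extremeOn-face aᵢ+aⱼ two aᵢ+aⱼ≤2 aᵢ+aⱼ-p
          (extremeOn-face (-ᴸ c₀-coordinate) (ℚ.- ℕtoℚ 0) -c₀≤0 -c₀-p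
            (extremeOn-face c₁-coordinate (ℕtoℚ (i + j ∸ (L + L))) c₁≤ c₁-p
              (extremeOn-singleton only))))
      where
        c₀-coordinate : Linear n
        c₀-coordinate = coordinate (inj₂ F.zero)
        c₀-bienum : ∀ G → φ c₀-coordinate (bienum G) ≡ ℕtoℚ (n + common G ∸ (deg₁ G + deg₂ G))
        c₀-bienum G = trans (φ-bienum c₀-coordinate G) (c₀-bn n (deg₁ G) (deg₂ G) (common G) (proj₂ (proj₂ (realizable G))))
        -c₀-p : φ (-ᴸ c₀-coordinate) (bn n i j L) ≡ ℚ.- ℕtoℚ 0
        -c₀-p = cong ℚ.-_ (trans (c₀-bn n i j L (ℕP.m≤n+m∸n (i + j) n))
                                 (cong ℕtoℚ (trans (cong (_∸ (i + j)) (ℕP.m+[n∸m]≡n (ℕP.<⇒≤ large))) (ℕP.n∸n≡0 (i + j)))))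
        -c₀≤0 : ∀ G → Face₁ G → φ (-ᴸ c₀-coordinate) (bienum G) ℚ.≤ ℚ.- ℕtoℚ 0
        -c₀≤0 G _ = subst (ℚ._≤ ℚ.- ℕtoℚ 0) (sym (cong ℚ.-_ (c₀-bienum G)))
                      (ℚP.neg-antimono-≤ (ℕtoℚ-mono-≤ {0} {n + common G ∸ (deg₁ G + deg₂ G)} z≤n))
        Face₂ : Subgraph n → Set
        Face₂ = OnFace Face₁ (-ᴸ c₀-coordinate) (ℚ.- ℕtoℚ 0)
        tight : ∀ {G} → Face₂ G → deg₁ G + deg₂ G ≡ n + common G
        tight {G} (face _ -c₀≡0) = ℕP.≤-antisym (proj₂ (proj₂ (realizable G)))
          (ℕP.m∸n≡0⇒m≤n (ℕtoℚ-injective (ℚP.neg-injective (trans (sym (cong ℚ.-_ (c₀-bienum G))) -c₀≡0))))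
        c₁-value : ∀ {G} → Face₂ G
                 → deg₁ G + deg₂ G ∸ (common G + common G) ≤ i + j ∸ (L + L)
                 × (deg₁ G + deg₂ G ∸ (common G + common G) ≡ i + j ∸ (L + L)
                    → IsPair i j (deg₁ G) (deg₂ G) × common G ≡ L)
        c₁-value {G} face₂@(face face₁ _) =
          c₁-bound 2i<n n<2j large j≤n (proj₁ (degrees face₁)) (proj₂ (degrees face₁)) (tight face₂) (proj₁ (realizable G))
        c₁≤ : ∀ G → Face₂ G → φ c₁-coordinate (bienum G) ℚ.≤ ℕtoℚ (i + j ∸ (L + L))
        c₁≤ G face₂ = subst (ℚ._≤ ℕtoℚ (i + j ∸ (L + L))) (sym (c₁-bienum G)) (ℕtoℚ-mono-≤ (proj₁ (c₁-value face₂)))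
        only : ∀ G → OnFace Face₂ c₁-coordinate (ℕtoℚ (i + j ∸ (L + L))) G → bienum G ≡ bn n i j L
        only G (face face₂ c₁≡) = bienum≡p G (proj₁ on-p) (proj₂ on-p)
          where
            on-p : IsPair i j (deg₁ G) (deg₂ G) × common G ≡ L
            on-p = proj₂ (c₁-value face₂) (ℕtoℚ-injective (trans (sym (c₁-bienum G)) c₁≡))

    vertex-by-size : Dec (i + j ≤ n) → IsVertex n (bn n i j L)
    vertex-by-size (yes small) = vertex-if-small small
    vertex-by-size (no  large) = vertex-if-large (ℕP.≰⇒> large)

  off-diagonal-vertex : IsVertex n (bn n i j (i + j ∸ n))
  off-diagonal-vertex = vertex-by-size (i + j ℕP.≤? n)

-- Points that are not vertices

vertex-mix : ∀ {n p x y t} → IsVertex n p → InConv n x → InConv n y → 0ℚ ℚ.< t → t ℚ.< 1ℚ → p ≡ mix t x y → x ≡ p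
vertex-mix (_ , extreme) x∈ y∈ t>0 t<1 p≡ = proj₁ (extreme _ _ _ x∈ y∈ t>0 t<1 p≡)

bn-injectiveᵏ : ∀ n a b k a' b' k' → bn n a b k ≡ bn n a' b' k' → k ≡ k'
bn-injectiveᵏ n a b k a' b' k' e = ℕtoℚ-injective (cong (λ p → coord p (inj₂ (F.suc (F.suc F.zero)))) e)

0<½ : 0ℚ ℚ.< ½
0<½ = ℚP.positive⁻¹ ½

½<1 : ½ ℚ.< 1ℚ
½<1 = ℚ.*<* (ℤ.+<+ (s≤s (s≤s z≤n)))

ℕtoℚ-suc : ∀ m → ℕtoℚ (suc m) ≡ 1ℚ ℚ.+ ℕtoℚ m
ℕtoℚ-suc m = ℕtoℚ-+ 1 m

bn-common-midpoint : ∀ n a b k → bn n a b (suc k) ≡ mix ½ (bn n a b k) (bn n a b (suc (suc k)))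
bn-common-midpoint n a b k =
  shape-unique (bn-shape n a b (suc k)) (shape-mix ½ (bn-shape n a b k) (bn-shape n a b (suc (suc k))))
    (λ x → solve 2 (λ X Y → X :+ Y := con ½ :* (X :+ Y) :+ con ½ :* (X :+ Y)) refl (δ x a) (δ x b))
    (solve 1 (λ S → S := con ½ :* S :+ con ½ :* S) refl (ℕtoℚ (a + b)))
    (trans (ℕtoℚ-suc k)
      (trans (solve 1 (λ K → con 1ℚ :+ K := con ½ :* K :+ con ½ :* (con 1ℚ :+ (con 1ℚ :+ K))) refl (ℕtoℚ k))
        (cong (λ z → ½ ℚ.* ℕtoℚ k ℚ.+ ½ ℚ.* z) (sym (trans (ℕtoℚ-suc (suc k)) (cong (1ℚ ℚ.+_) (ℕtoℚ-suc k)))))))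

¬vertex-common-interior : ∀ {n a b k} → Realizable n a b k → Realizable n a b (suc (suc k))
                        → ¬ IsVertex n (bn n a b (suc k))
¬vertex-common-interior {n} {a} {b} {k} r r′ V =
  ℕP.<-irrefl (bn-injectiveᵏ n a b k a b (suc k) (vertex-mix V (inConv-bn r) (inConv-bn r′) 0<½ ½<1 (bn-common-midpoint n a b k)))
              (ℕP.n<1+n k)

bn-diagonal-midpoint : ∀ n a b L Lᵃ Lᵇ → L + L ≡ Lᵃ + Lᵇ → bn n a b L ≡ mix ½ (bn n a a Lᵃ) (bn n b b Lᵇ)
bn-diagonal-midpoint n a b L Lᵃ Lᵇ 2L≡ =
  shape-unique (bn-shape n a b L) (shape-mix ½ (bn-shape n a a Lᵃ) (bn-shape n b b Lᵇ))
    (λ x → solve 2 (λ X Y → X :+ Y := con ½ :* (X :+ X) :+ con ½ :* (Y :+ Y)) refl (δ x a) (δ x b))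
    (trans (ℕtoℚ-+ a b)
      (trans (solve 2 (λ A B → A :+ B := con ½ :* (A :+ A) :+ con ½ :* (B :+ B)) refl (ℕtoℚ a) (ℕtoℚ b))
        (sym (cong₂ (λ u v → ½ ℚ.* u ℚ.+ ½ ℚ.* v) (ℕtoℚ-+ a a) (ℕtoℚ-+ b b)))))
    (trans (solve 1 (λ L → L := con ½ :* (L :+ L)) refl (ℕtoℚ L))
      (trans (cong (½ ℚ.*_) (trans (sym (ℕtoℚ-+ L L)) (trans (cong ℕtoℚ 2L≡) (ℕtoℚ-+ Lᵃ Lᵇ))))
        (ℚP.*-distribˡ-+ ½ (ℕtoℚ Lᵃ) (ℕtoℚ Lᵇ))))

¬vertex-between-diagonals : ∀ {n a b L Lᵃ Lᵇ} → a ≢ b → a ≤ n → Realizable n a a Lᵃ → Realizable n b b Lᵇ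
                          → L + L ≡ Lᵃ + Lᵇ → ¬ IsVertex n (bn n a b L)
¬vertex-between-diagonals {n} {a} {b} {L} {Lᵃ} {Lᵇ} a≢b a≤n rᵃ rᵇ 2L≡ V = 2≢1 (begin
    1ℚ ℚ.+ 1ℚ                          ≡⟨ sym (cong₂ ℚ._+_ (δ-refl a) (δ-refl a)) ⟩
    δ a a ℚ.+ δ a a                    ≡⟨ sym (degree-coordinate-bn a≤n a a Lᵃ) ⟩
    Linear.φ aₐ (bn n a a Lᵃ)          ≡⟨ cong (Linear.φ aₐ) x≡p ⟩
    Linear.φ aₐ (bn n a b L)           ≡⟨ degree-coordinate-bn a≤n a b L ⟩
    δ a a ℚ.+ δ a b                    ≡⟨ cong₂ ℚ._+_ (δ-refl a) (δ-≢ a≢b) ⟩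
    1ℚ ℚ.+ 0ℚ                          ∎)
  where
    open ≡-Reasoning
    aₐ : Linear n
    aₐ = degree-coordinate a≤n
    x≡p : bn n a a Lᵃ ≡ bn n a b L
    x≡p = vertex-mix V (inConv-bn rᵃ) (inConv-bn rᵇ) 0<½ ½<1 (bn-diagonal-midpoint n a b L Lᵃ Lᵇ 2L≡)
    2≢1 : 1ℚ ℚ.+ 1ℚ ≢ 1ℚ ℚ.+ 0ℚ
    2≢1 ()

module _ (a′ d : ℕ) where
  private
    a b : ℕ
    a = suc a′
    b = suc (a + d)
    A′ D : ℚ
    A′ = ℕtoℚ a′
    D  = ℕtoℚ (suc d)
    W : ℚ
    W = ℕtoℚ (suc d + 2)
    W>0 : 0ℚ ℚ.< W
    W>0 = ℚP.<-≤-trans (ℚP.positive⁻¹ 1ℚ) (ℕtoℚ-mono-≤ {1} {suc d + 2} (s≤s z≤n))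
    instance
      W-pos : ℚ.Positive W
      W-pos = ℚ.positive W>0
      W≢0 : ℚ.NonZero W
      W≢0 = ℚP.pos⇒nonZero W
    -- t = (b - a) / (b - a + 2) is the weight making the c₂-coordinates agree: t (a - 1) + (1 - t) (a + b) / 2 = a
    u t : ℚ
    u = ℚ.1/ W
    t = D ℚ.* u

    u*[D+2]≡1 : u ℚ.* (D ℚ.+ 1ℚ ℚ.+ 1ℚ) ≡ 1ℚ
    u*[D+2]≡1 = trans (cong (u ℚ.*_) (sym (trans (ℕtoℚ-+ (suc d) 2) (sym (ℚP.+-assoc D 1ℚ 1ℚ)))))
                      (ℚP.*-inverseˡ W)

  bn-top-split : ∀ n → bn n a b a ≡ mix t (bn n a b a′) (mix ½ (bn n a a a) (bn n b b b))
  bn-top-split n =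
    shape-unique (bn-shape n a b a) (shape-mix t (bn-shape n a b a′) (shape-mix ½ (bn-shape n a a a) (bn-shape n b b b)))
      (λ x → solve 3 (λ X Y t → X :+ Y := t :* (X :+ Y) :+ (con 1ℚ :- t) :* (con ½ :* (X :+ X) :+ con ½ :* (Y :+ Y)))
                     refl (δ x a) (δ x b) t)
      S-eq K-eq
    where
      open ≡-Reasoning
      S-eq : ℕtoℚ (a + b) ≡ t ℚ.* ℕtoℚ (a + b) ℚ.+ (1ℚ ℚ.- t) ℚ.* (½ ℚ.* ℕtoℚ (a + a) ℚ.+ ½ ℚ.* ℕtoℚ (b + b))
      S-eq = begin
        ℕtoℚ (a + b)
          ≡⟨ ℕtoℚ-+ a b ⟩
        ℕtoℚ a ℚ.+ ℕtoℚ b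
          ≡⟨ solve 3 (λ A B t → A :+ B := t :* (A :+ B) :+ (con 1ℚ :- t) :* (con ½ :* (A :+ A) :+ con ½ :* (B :+ B)))
                     refl (ℕtoℚ a) (ℕtoℚ b) t ⟩
        t ℚ.* (ℕtoℚ a ℚ.+ ℕtoℚ b) ℚ.+ (1ℚ ℚ.- t) ℚ.* (½ ℚ.* (ℕtoℚ a ℚ.+ ℕtoℚ a) ℚ.+ ½ ℚ.* (ℕtoℚ b ℚ.+ ℕtoℚ b))
          ≡⟨ sym (cong₂ (λ s v → t ℚ.* s ℚ.+ (1ℚ ℚ.- t) ℚ.* v) (ℕtoℚ-+ a b)
                         (cong₂ (λ v w → ½ ℚ.* v ℚ.+ ½ ℚ.* w) (ℕtoℚ-+ a a) (ℕtoℚ-+ b b))) ⟩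
        t ℚ.* ℕtoℚ (a + b) ℚ.+ (1ℚ ℚ.- t) ℚ.* (½ ℚ.* ℕtoℚ (a + a) ℚ.+ ½ ℚ.* ℕtoℚ (b + b)) ∎
      b≡ : ℕtoℚ b ≡ 1ℚ ℚ.+ A′ ℚ.+ D
      b≡ = trans (cong ℕtoℚ (sym (ℕP.+-suc a d))) (trans (ℕtoℚ-+ a (suc d)) (cong (ℚ._+ D) (ℕtoℚ-suc a′)))
      K-eq : ℕtoℚ a ≡ t ℚ.* A′ ℚ.+ (1ℚ ℚ.- t) ℚ.* (½ ℚ.* ℕtoℚ a ℚ.+ ½ ℚ.* ℕtoℚ b)
      K-eq = sym (begin
        t ℚ.* A′ ℚ.+ (1ℚ ℚ.- t) ℚ.* (½ ℚ.* ℕtoℚ a ℚ.+ ½ ℚ.* ℕtoℚ b)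
          ≡⟨ cong₂ (λ v w → t ℚ.* A′ ℚ.+ (1ℚ ℚ.- t) ℚ.* (½ ℚ.* v ℚ.+ ½ ℚ.* w)) (ℕtoℚ-suc a′) b≡ ⟩
        t ℚ.* A′ ℚ.+ (1ℚ ℚ.- t) ℚ.* (½ ℚ.* (1ℚ ℚ.+ A′) ℚ.+ ½ ℚ.* (1ℚ ℚ.+ A′ ℚ.+ D))
          ≡⟨ solve 3 (λ A′ D u → (D :* u) :* A′ :+ (con 1ℚ :- D :* u) :* (con ½ :* (con 1ℚ :+ A′) :+ con ½ :* (con 1ℚ :+ A′ :+ D))
                                 := (con 1ℚ :+ A′) :+ (D :* con ½) :* (con 1ℚ :- u :* (D :+ con 1ℚ :+ con 1ℚ))) refl A′ D u ⟩
        (1ℚ ℚ.+ A′) ℚ.+ (D ℚ.* ½) ℚ.* (1ℚ ℚ.- u ℚ.* (D ℚ.+ 1ℚ ℚ.+ 1ℚ))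
          ≡⟨ cong (λ z → (1ℚ ℚ.+ A′) ℚ.+ (D ℚ.* ½) ℚ.* (1ℚ ℚ.- z)) u*[D+2]≡1 ⟩
        (1ℚ ℚ.+ A′) ℚ.+ (D ℚ.* ½) ℚ.* (1ℚ ℚ.- 1ℚ)
          ≡⟨ solve 2 (λ A′ D → (con 1ℚ :+ A′) :+ (D :* con ½) :* (con 1ℚ :- con 1ℚ) := con 1ℚ :+ A′) refl A′ D ⟩
        1ℚ ℚ.+ A′
          ≡⟨ sym (ℕtoℚ-suc a′) ⟩
        ℕtoℚ a ∎)

  ¬vertex-top-common : ∀ {n} → b ≤ n → a + b ≤ n + a′ → ¬ IsVertex n (bn n a b a)
  ¬vertex-top-common {n} b≤n feasible V = ℕP.<-irrefl (bn-injectiveᵏ n a b a′ a b a x≡p) (ℕP.n<1+n a′)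
    where
      a≤b : a ≤ b
      a≤b = ℕP.≤-trans (ℕP.m≤m+n a d) (ℕP.n≤1+n _)
      diagonal∈ : ∀ {c} → c ≤ n → InConv n (bn n c c c)
      diagonal∈ {c} c≤n = inConv-bn (ℕP.≤-refl , ℕP.≤-refl , ℕP.+-monoˡ-≤ c c≤n)
      x∈ : InConv n (bn n a b a′)
      x∈ = inConv-bn (ℕP.n≤1+n a′ , ℕP.≤-trans (ℕP.n≤1+n a′) a≤b , feasible)
      y∈ : InConv n (mix ½ (bn n a a a) (bn n b b b))
      y∈ = inConv-mix (ℚP.<⇒≤ 0<½) (ℚP.<⇒≤ ½<1) (diagonal∈ (ℕP.≤-trans a≤b b≤n)) (diagonal∈ b≤n)
      u>0 : 0ℚ ℚ.< u
      u>0 = ℚP.positive⁻¹ u {{ℚP.1/pos⇒pos W}}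
      t>0 : 0ℚ ℚ.< t
      t>0 = subst (ℚ._< t) (ℚP.*-zeroˡ u)
              (ℚP.*-monoˡ-<-pos u {{ℚ.positive u>0}} (ℚP.<-≤-trans (ℚP.positive⁻¹ 1ℚ) (ℕtoℚ-mono-≤ {1} {suc d} (s≤s z≤n))))
      1-t≡2u : 1ℚ ℚ.- t ≡ u ℚ.+ u
      1-t≡2u = trans (cong (ℚ._- t) (sym u*[D+2]≡1)) (solve 2 (λ u D → u :* (D :+ con 1ℚ :+ con 1ℚ) :- D :* u := u :+ u) refl u D)
      t<1 : t ℚ.< 1ℚ
      t<1 = 0<1-⇒< (subst (0ℚ ℚ.<_) (sym 1-t≡2u) (ℚP.+-mono-< u>0 u>0))
      x≡p : bn n a b a′ ≡ bn n a b a
      x≡p = vertex-mix V x∈ y∈ t>0 t<1 (bn-top-split n)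

≤⌊/2⌋⇒+≤ : ∀ {i m} → i ≤ ⌊ m /2⌋ → i + i ≤ m
≤⌊/2⌋⇒+≤ {i} {m} h = ℕP.≤-trans (ℕP.+-mono-≤ h (ℕP.≤-trans h (ℕP.⌊n/2⌋≤⌈n/2⌉ m))) (ℕP.≤-reflexive (ℕP.⌊n/2⌋+⌈n/2⌉≡n m))

+≤⇒≤⌊/2⌋ : ∀ {i m} → i + i ≤ m → i ≤ ⌊ m /2⌋
+≤⇒≤⌊/2⌋ {i} {m} h = subst (_≤ ⌊ m /2⌋) (sym (ℕP.n≡⌊n+n/2⌋ i)) (ℕP.⌊n/2⌋-mono h)

⌈/2⌉≤⇒≤+ : ∀ {j m} → ⌈ m /2⌉ ≤ j → m ≤ j + j
⌈/2⌉≤⇒≤+ {j} {m} h = ℕP.≤-trans (ℕP.≤-reflexive (sym (ℕP.⌊n/2⌋+⌈n/2⌉≡n m))) (ℕP.+-mono-≤ (ℕP.≤-trans (ℕP.⌊n/2⌋≤⌈n/2⌉ m) h) h)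

≤+⇒⌈/2⌉≤ : ∀ {j m} → m ≤ j + j → ⌈ m /2⌉ ≤ j
≤+⇒⌈/2⌉≤ {j} {m} h = subst (⌈ m /2⌉ ≤_) (sym (ℕP.n≡⌈n+n/2⌉ j)) (ℕP.⌈n/2⌉-mono h)

module _ {n : ℕ} where

  ¬vertex-interior : ∀ {a b k} → a ≤ b → a + b ∸ n < k → k < a → ¬ IsVertex n (bn n a b k)
  ¬vertex-interior {a} {b} {suc k′} a≤b L<k k<a =
    ¬vertex-common-interior (k′≤a , ℕP.≤-trans k′≤a a≤b , feasible′)
                            (k<a , ℕP.≤-trans k<a a≤b , ℕP.≤-trans feasible′ (ℕP.+-monoʳ-≤ n (ℕP.m≤n+m k′ 2)))
    where
      k′≤a : k′ ≤ a
      k′≤a = ℕP.≤-trans (ℕP.n≤1+n k′) (ℕP.<⇒≤ k<a)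
      feasible′ : a + b ≤ n + k′
      feasible′ = ℕP.≤-trans (ℕP.m≤n+m∸n (a + b) n) (ℕP.+-monoʳ-≤ n (s≤s⁻¹ L<k))

  diagonal-vertex⇒ : ∀ {a k} → Realizable n a a k → IsVertex n (bn n a a k) → k ≡ 2 * a ∸ n ⊎ k ≡ a
  diagonal-vertex⇒ {a} {k} (k≤a , _ , feasible) = by-cases (k ℕP.≟ 2 * a ∸ n) (k ℕP.≟ a)
    where
      by-cases : Dec (k ≡ 2 * a ∸ n) → Dec (k ≡ a) → IsVertex n (bn n a a k) → k ≡ 2 * a ∸ n ⊎ k ≡ a
      by-cases (yes k≡L) _         _ = inj₁ k≡L
      by-cases (no _)    (yes k≡a) _ = inj₂ k≡a
      by-cases (no k≢L)  (no k≢a)  V = ⊥-elim (¬vertex-interior ℕP.≤-refl L<k (ℕP.≤∧≢⇒< k≤a k≢a) V)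
        where
          L<k : a + a ∸ n < k
          L<k = ℕP.≤∧≢⇒< (ℕP.m≤n+o⇒m∸n≤o (a + a) n feasible) (λ e → k≢L (trans (sym e) (cong (_∸ n) (sym (2*≡+ a)))))

  ¬vertex-top : ∀ {a b} → a < b → b ≤ n → a + b ∸ n < a → ¬ IsVertex n (bn n a b a)
  ¬vertex-top {suc a′} {b} a<b b≤n L<a =
    subst (λ b → ¬ IsVertex n (bn n (suc a′) b (suc a′))) b≡
      (¬vertex-top-common a′ d (subst (_≤ n) (sym b≡) b≤n)
        (subst (λ b → suc a′ + b ≤ n + a′) (sym b≡) (ℕP.≤-trans (ℕP.m≤n+m∸n (suc a′ + b) n) (ℕP.+-monoʳ-≤ n (s≤s⁻¹ L<a)))))
    where
      d : ℕ
      d = b ∸ suc (suc a′)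
      b≡ : suc (suc a′ + d) ≡ b
      b≡ = ℕP.m+[n∸m]≡n a<b

  bottoms-average-large : ∀ {a b} → a ≤ b → n ≤ a + a → (a + b ∸ n) + (a + b ∸ n) ≡ (2 * a ∸ n) + (2 * b ∸ n)
  bottoms-average-large {a} {b} a≤b n≤2a = ℕP.+-cancelˡ-≡ (n + n) _ _ (begin
      n + n + (L + L)              ≡⟨ interchange n n L L ⟩
      (n + L) + (n + L)            ≡⟨ cong₂ _+_ n+L≡ n+L≡ ⟩
      (a + b) + (a + b)            ≡⟨ regroup a b ⟩
      2 * a + 2 * b                ≡⟨ sym (cong₂ _+_ (ℕP.m+[n∸m]≡n n≤2*a) (ℕP.m+[n∸m]≡n n≤2*b)) ⟩
      (n + Lᵃ) + (n + Lᵇ)          ≡⟨ interchange n Lᵃ n Lᵇ ⟩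
      n + n + (Lᵃ + Lᵇ)            ∎)
    where
      open ≡-Reasoning
      L Lᵃ Lᵇ : ℕ
      L = a + b ∸ n
      Lᵃ = 2 * a ∸ n
      Lᵇ = 2 * b ∸ n
      interchange : ∀ w x y z → w + x + (y + z) ≡ (w + y) + (x + z)
      interchange = solve-∀
      regroup : ∀ a b → (a + b) + (a + b) ≡ 2 * a + 2 * b
      regroup = solve-∀
      n≤2*a : n ≤ 2 * a
      n≤2*a = subst (n ≤_) (sym (2*≡+ a)) n≤2a
      n≤2*b : n ≤ 2 * b
      n≤2*b = ℕP.≤-trans n≤2*a (ℕP.*-monoʳ-≤ 2 a≤b)
      n+L≡ : n + L ≡ a + b
      n+L≡ = ℕP.m+[n∸m]≡n (ℕP.≤-trans n≤2a (ℕP.+-monoʳ-≤ a a≤b))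

  bottoms-average-small : ∀ {a b} → a ≤ b → b + b ≤ n → (a + b ∸ n) + (a + b ∸ n) ≡ (2 * a ∸ n) + (2 * b ∸ n)
  bottoms-average-small {a} {b} a≤b 2b≤n =
    trans (cong (λ l → l + l) (ℕP.m≤n⇒m∸n≡0 (ℕP.≤-trans (ℕP.+-monoˡ-≤ b a≤b) 2b≤n)))
          (sym (cong₂ _+_ (ℕP.m≤n⇒m∸n≡0 (ℕP.≤-trans (ℕP.*-monoʳ-≤ 2 a≤b) 2*b≤n)) (ℕP.m≤n⇒m∸n≡0 2*b≤n)))
    where
      2*b≤n : 2 * b ≤ n
      2*b≤n = subst (_≤ n) (sym (2*≡+ b)) 2b≤n

  ¬vertex-above-bottom : ∀ {a b k} → a < b → b ≤ n → k ≤ a → a + b ∸ n < k → ¬ IsVertex n (bn n a b k)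
  ¬vertex-above-bottom {a} {b} {k} a<b b≤n k≤a L<k = by-cases (k ℕP.≟ a)
    where
      by-cases : Dec (k ≡ a) → ¬ IsVertex n (bn n a b k)
      by-cases (yes k≡a) = subst (λ k → ¬ IsVertex n (bn n a b k)) (sym k≡a) (¬vertex-top a<b b≤n (subst (a + b ∸ n <_) k≡a L<k))
      by-cases (no k≢a)  = ¬vertex-interior (ℕP.<⇒≤ a<b) L<k (ℕP.≤∧≢⇒< k≤a k≢a)

  ¬vertex-bottom-between-diagonals : ∀ {a b} → a < b → b ≤ n
    → (a + b ∸ n) + (a + b ∸ n) ≡ (2 * a ∸ n) + (2 * b ∸ n) → ¬ IsVertex n (bn n a b (a + b ∸ n))
  ¬vertex-bottom-between-diagonals {a} {b} a<b b≤n =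
    ¬vertex-between-diagonals (ℕP.<⇒≢ a<b) a≤n (diagonal-bottom-realizable a≤n) (diagonal-bottom-realizable b≤n)
    where
      a≤n : a ≤ n
      a≤n = ℕP.≤-trans (ℕP.<⇒≤ a<b) b≤n

  off-diagonal-vertex⇒ : ∀ {a b k} → a < b → b ≤ n → Realizable n a b k → IsVertex n (bn n a b k)
                       → k ≡ a + b ∸ n × suc (a + a) ≤ n × suc n ≤ b + b
  off-diagonal-vertex⇒ {a} {b} {k} a<b b≤n (k≤a , _ , feasible) =
    by-cases (k ℕP.≟ a + b ∸ n) (suc (a + a) ℕP.≤? n) (suc n ℕP.≤? b + b)
    where
      L : ℕ
      L = a + b ∸ n
      at-bottom : k ≡ L → ¬ IsVertex n (bn n a b L) → ¬ IsVertex n (bn n a b k)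
      at-bottom k≡L = subst (λ k → ¬ IsVertex n (bn n a b k)) (sym k≡L)
      by-cases : Dec (k ≡ L) → Dec (suc (a + a) ≤ n) → Dec (suc n ≤ b + b)
               → IsVertex n (bn n a b k) → k ≡ L × suc (a + a) ≤ n × suc n ≤ b + b
      by-cases (no k≢L) _ _ V =
        ⊥-elim (¬vertex-above-bottom a<b b≤n k≤a (ℕP.≤∧≢⇒< (ℕP.m≤n+o⇒m∸n≤o (a + b) n feasible) (k≢L ∘ sym)) V)
      by-cases (yes k≡L) (yes 2a<n) (yes n<2b) _ = k≡L , 2a<n , n<2b
      by-cases (yes k≡L) (no 2a≮n) _ V = ⊥-elim (at-bottom k≡L (¬vertex-bottom-between-diagonals a<b b≤n
        (bottoms-average-large (ℕP.<⇒≤ a<b) (s≤s⁻¹ (ℕP.≰⇒> 2a≮n)))) V)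
      by-cases (yes k≡L) (yes _) (no n≮2b) V = ⊥-elim (at-bottom k≡L (¬vertex-bottom-between-diagonals a<b b≤n
        (bottoms-average-small (ℕP.<⇒≤ a<b) (s≤s⁻¹ (ℕP.≰⇒> n≮2b)))) V)

realizable⇒≤ : ∀ {n a b k} → Realizable n a b k → a ≤ n × b ≤ n
realizable⇒≤ {n} {a} {b} {k} (k≤a , k≤b , feasible) =
  ℕP.+-cancelʳ-≤ b a n (ℕP.≤-trans feasible (ℕP.+-monoʳ-≤ n k≤b)) ,
  ℕP.+-cancelˡ-≤ a b n (ℕP.≤-trans feasible (subst (n + k ≤_) (ℕP.+-comm n a) (ℕP.+-monoʳ-≤ n k≤a)))

realizable-swap : ∀ {n a b k} → Realizable n a b k → Realizable n b a k
realizable-swap {n} {a} {b} {k} (k≤a , k≤b , feasible) = k≤b , k≤a , subst (_≤ n + k) (ℕP.+-comm a b) feasible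

<⇒≤⌊pred/2⌋ : ∀ {n i} → suc (i + i) ≤ n → i ≤ ⌊ n ∸ 1 /2⌋
<⇒≤⌊pred/2⌋ (s≤s 2i≤n-1) = +≤⇒≤⌊/2⌋ 2i≤n-1

≤⌊pred/2⌋⇒< : ∀ {n i} → 1 ≤ n → i ≤ ⌊ n ∸ 1 /2⌋ → suc (i + i) ≤ n
≤⌊pred/2⌋⇒< (s≤s z≤n) h = s≤s (≤⌊/2⌋⇒+≤ h)

<⇒⌈suc/2⌉≤ : ∀ {n j} → suc n ≤ j + j → ⌈ n + 1 /2⌉ ≤ j
<⇒⌈suc/2⌉≤ {n} {j} h = ≤+⇒⌈/2⌉≤ (subst (_≤ j + j) (ℕP.+-comm 1 n) h)

⌈suc/2⌉≤⇒< : ∀ {n j} → ⌈ n + 1 /2⌉ ≤ j → suc n ≤ j + j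
⌈suc/2⌉≤⇒< {n} {j} h = subst (_≤ j + j) (ℕP.+-comm n 1) (⌈/2⌉≤⇒≤+ h)

bn-vertex⇒listed : ∀ {n a b k} → Realizable n a b k → IsVertex n (bn n a b k) → IsListedVertex n (bn n a b k)
bn-vertex⇒listed {n} {a} {b} {k} r = by-order (ℕP.<-cmp a b)
  where
    a≤n : a ≤ n
    a≤n = proj₁ (realizable⇒≤ r)
    b≤n : b ≤ n
    b≤n = proj₂ (realizable⇒≤ r)
    off-diagonal : ∀ {i j} → i < j → j ≤ n → Realizable n i j k → IsVertex n (bn n i j k)
                 → IsListedVertex n (bn n i j k)
    off-diagonal {i} {j} i<j j≤n rᵢⱼ V with off-diagonal-vertex⇒ i<j j≤n rᵢⱼ V
    ... | k≡L , 2i<n , n<2j = inj₂ (i , j , <⇒≤⌊pred/2⌋ 2i<n , <⇒⌈suc/2⌉≤ n<2j , j≤n , cong (bn n i j) k≡L)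
    by-order : Tri (a < b) (a ≡ b) (b < a) → IsVertex n (bn n a b k) → IsListedVertex n (bn n a b k)
    by-order (tri< a<b _ _) V = off-diagonal a<b b≤n r V
    by-order (tri≈ _ a≡b _) V = subst (λ b → IsListedVertex n (bn n a b k)) a≡b
      (inj₁ (a , k , a≤n , diagonal-vertex⇒ r′ (subst (λ b → IsVertex n (bn n a b k)) (sym a≡b) V) , refl))
      where
        r′ : Realizable n a a k
        r′ = subst (λ b → Realizable n a b k) (sym a≡b) r
    by-order (tri> _ _ b<a) V = subst (IsListedVertex n) (sym (bn-swap n a b k))
      (off-diagonal b<a a≤n (realizable-swap r) (subst (IsVertex n) (bn-swap n a b k) V))

vertex⇒listed : ∀ {n} p → IsVertex n p → IsListedVertex n p
vertex⇒listed {n} p V = subst (IsListedVertex n) p≡ (bn-vertex⇒listed (realizable G) (subst (IsVertex n) (sym p≡) V))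
  where
    G : Subgraph n
    G = proj₁ (vertex⇒bienum V)
    p≡ : bn n (deg₁ G) (deg₂ G) (common G) ≡ p
    p≡ = trans (sym (bienum≡bn G)) (proj₂ (vertex⇒bienum V))

listed⇒vertex : ∀ {n} → 1 ≤ n → ∀ p → IsListedVertex n p → IsVertex n p
listed⇒vertex n≥1 _ (inj₁ (i , _ , i≤n , inj₁ refl , refl)) = diagonal-bottom-vertex i≤n
listed⇒vertex n≥1 _ (inj₁ (i , _ , i≤n , inj₂ refl , refl)) = diagonal-top-vertex i≤n
listed⇒vertex n≥1 _ (inj₂ (i , j , i≤ , ≤j , j≤n , refl)) =
  OffDiagonal.off-diagonal-vertex (≤⌊pred/2⌋⇒< n≥1 i≤) (⌈suc/2⌉≤⇒< ≤j) j≤n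

δ+δ≡⇒∈ : ∀ x b a' b' → δ x x ℚ.+ δ x b ≡ δ x a' ℚ.+ δ x b' → x ≡ a' ⊎ x ≡ b'
δ+δ≡⇒∈ x b a' b' e with x ℕP.≟ a' | x ℕP.≟ b'
... | yes x≡a' | _        = inj₁ x≡a'
... | no _     | yes x≡b' = inj₂ x≡b'
... | no x≢a'  | no x≢b'  =
  ⊥-elim (1+bit≢0 (x ≡ᵇ b) (trans (cong (ℚ._+ δ x b) (sym (δ-refl x))) (trans e (cong₂ ℚ._+_ (δ-≢ x≢a') (δ-≢ x≢b')))))
  where
    1+bit≢0 : ∀ p → 1ℚ ℚ.+ bit p ≢ 0ℚ ℚ.+ 0ℚ
    1+bit≢0 true  ()
    1+bit≢0 false ()

bn-degree∈ : ∀ {n a b k a' b' k'} → a ≤ n → bn n a b k ≡ bn n a' b' k' → a ≡ a' ⊎ a ≡ b'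
bn-degree∈ {n} {a} {b} {k} {a'} {b'} {k'} a≤n e = δ+δ≡⇒∈ a b a' b'
  (trans (sym (degree-coordinate-bn a≤n a b k)) (trans (cong (Linear.φ (degree-coordinate a≤n)) e) (degree-coordinate-bn a≤n a' b' k')))

bn-injective : ∀ {n i j k i' j' k'} → i ≤ j → i' ≤ j' → j ≤ n → j' ≤ n
             → bn n i j k ≡ bn n i' j' k' → (i , j , k) ≡ (i' , j' , k')
bn-injective {n} {i} {j} {k} {i'} {j'} {k'} i≤j i'≤j' j≤n j'≤n e =
  cong₂ _,_ i≡i' (cong₂ _,_ j≡j' (bn-injectiveᵏ n i j k i' j' k' e))
  where
    i≡i' : i ≡ i'
    i≡i' with bn-degree∈ (ℕP.≤-trans i≤j j≤n) e | bn-degree∈ (ℕP.≤-trans i'≤j' j'≤n) (sym e)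
    ... | inj₁ i≡i' | _          = i≡i'
    ... | inj₂ _    | inj₁ i'≡i  = sym i'≡i
    ... | inj₂ i≡j' | inj₂ i'≡j  = ℕP.≤-antisym (subst (i ≤_) (sym i'≡j) i≤j) (subst (i' ≤_) (sym i≡j') i'≤j')
    j≡j' : j ≡ j'
    j≡j' with bn-degree∈ j≤n (trans (bn-swap n j i k) e) | bn-degree∈ j'≤n (trans (bn-swap n j' i' k') (sym e))
    ... | inj₂ j≡j' | _          = j≡j'
    ... | inj₁ _    | inj₂ j'≡j  = sym j'≡j
    ... | inj₁ j≡i' | inj₁ j'≡i  = trans j≡i' (trans (sym i≡i') (sym j'≡i))

Unique-map⁺ : ∀ {A B : Set} (f : A → B) {xs : List A} → (∀ {x y} → x ∈ xs → y ∈ xs → f x ≡ f y → x ≡ y)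
            → Unique xs → Unique (map f xs)
Unique-map⁺ f {[]}     _   []          = []
Unique-map⁺ f {x ∷ xs} inj (x∉xs ∷ xs!) =
  All-map x∉xs (λ y∈ → there y∈) ∷ Unique-map⁺ f (λ x∈ y∈ → inj (there x∈) (there y∈)) xs!
  where
    All-map : ∀ {ys} → All (x ≢_) ys → (∀ {y} → y ∈ ys → y ∈ x ∷ xs) → All (f x ≢_) (map f ys)
    All-map []            _   = []
    All-map (x≢y ∷ x∉ys) sub = (x≢y ∘ inj (here refl) (sub (here refl))) ∷ All-map x∉ys (sub ∘ there)

length-cartesianProductWith : ∀ {A B C : Set} (f : A → B → C) (xs : List A) (ys : List B)
                            → length (cartesianProductWith f xs ys) ≡ length xs * length ys
length-cartesianProductWith f []       ys = refl
length-cartesianProductWith f (x ∷ xs) ys =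
  trans (LP.length-++ (map (f x) ys)) (cong₂ _+_ (LP.length-map (f x) ys) (length-cartesianProductWith f xs ys))

Triple : Set
Triple = ℕ × ℕ × ℕ

module VertexList (n : ℕ) (n≥1 : 1 ≤ n) where

  i-max j-min : ℕ
  i-max = ⌊ n ∸ 1 /2⌋
  j-min = ⌈ n + 1 /2⌉

  bottom top : ℕ → Triple
  bottom i = i , i , 2 * i ∸ n
  top    i = suc i , suc i , suc i

  off : ℕ → ℕ → Triple
  off i j = i , j , i + j ∸ n

  highs : List ℕ
  highs = applyUpTo (j-min +_) (suc n ∸ j-min)

  bottoms tops offs triples : List Triple
  bottoms = applyUpTo bottom (suc n)
  -- b_n(i,i,i) for 0 < i < n; for i = 0 and i = n it is already a bottom point
  tops    = applyUpTo top (n ∸ 1)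
  offs    = cartesianProductWith off (upTo (suc i-max)) highs
  triples = bottoms ++ tops ++ offs

  point : Triple → Point n
  point (i , j , k) = bn n i j k

  vertices : List (Point n)
  vertices = map point triples

  point∈ : ∀ {t} → t ∈ triples → point t ∈ vertices
  point∈ = ∈-map⁺ point

  j-min≤1+n : j-min ≤ suc n
  j-min≤1+n = subst (j-min ≤_) (ℕP.+-comm n 1) (ℕP.⌈n/2⌉≤n (n + 1))

  ∈highs⁻ : ∀ {j} → j ∈ highs → j-min ≤ j × j ≤ n
  ∈highs⁻ j∈ with ∈-applyUpTo⁻ (j-min +_) j∈
  ... | m , m<1+n-j-min , refl =
    ℕP.m≤m+n j-min m , s≤s⁻¹ (subst (suc (j-min + m) ≤_) (ℕP.m+[n∸m]≡n j-min≤1+n)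
                                (subst (_≤ j-min + (suc n ∸ j-min)) (ℕP.+-suc j-min m) (ℕP.+-monoʳ-≤ j-min m<1+n-j-min)))

  ∈highs⁺ : ∀ {j} → j-min ≤ j → j ≤ n → j ∈ highs
  ∈highs⁺ j-min≤j j≤n = subst (_∈ highs) (ℕP.m+[n∸m]≡n j-min≤j) (∈-applyUpTo⁺ (j-min +_) (ℕP.∸-monoˡ-< (s≤s j≤n) j-min≤j))

  off-ordered : ∀ {i j} → i ≤ i-max → j-min ≤ j → i < j
  off-ordered i≤i-max j-min≤j = 2i<n<2j⇒i<j (≤⌊pred/2⌋⇒< n≥1 i≤i-max) (⌈suc/2⌉≤⇒< j-min≤j)

  data Kind : Triple → Set where
    bottomᵏ : ∀ {i} → i ≤ n → Kind (bottom i)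
    topᵏ    : ∀ {i} → suc i < n → Kind (top i)
    offᵏ    : ∀ {i j} → i ≤ i-max → j-min ≤ j → j ≤ n → Kind (off i j)

  ∈triples⁻ : ∀ {t} → t ∈ triples → Kind t
  ∈triples⁻ t∈ with ∈-++⁻ bottoms t∈
  ... | inj₁ t∈bottoms with ∈-applyUpTo⁻ bottom t∈bottoms
  ...   | i , i<1+n , refl = bottomᵏ (s≤s⁻¹ i<1+n)
  ∈triples⁻ t∈ | inj₂ t∈rest with ∈-++⁻ tops t∈rest
  ... | inj₁ t∈tops with ∈-applyUpTo⁻ top t∈tops
  ...   | i , i<n-1 , refl = topᵏ (subst (suc (suc i) ≤_) (ℕP.m+[n∸m]≡n n≥1) (s≤s i<n-1))
  ∈triples⁻ t∈ | inj₂ t∈rest | inj₂ t∈offs with ∈-cartesianProductWith⁻ off (upTo (suc i-max)) highs t∈offs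
  ... | i , j , i∈ , j∈ , refl = offᵏ (s≤s⁻¹ (∈-upTo⁻ i∈)) (proj₁ (∈highs⁻ j∈)) (proj₂ (∈highs⁻ j∈))

  bottom∈ : ∀ {i} → i ≤ n → bottom i ∈ triples
  bottom∈ i≤n = ∈-++⁺ˡ (∈-applyUpTo⁺ bottom (s≤s i≤n))

  top∈ : ∀ {i} → suc i < n → top i ∈ triples
  top∈ {i} i+1<n = ∈-++⁺ʳ bottoms (∈-++⁺ˡ (∈-applyUpTo⁺ top (s≤s⁻¹ (subst (suc (suc i) ≤_) (sym (ℕP.m+[n∸m]≡n n≥1)) i+1<n))))

  off∈ : ∀ {i j} → i ≤ i-max → j-min ≤ j → j ≤ n → off i j ∈ triples
  off∈ i≤i-max j-min≤j j≤n = ∈-++⁺ʳ bottoms (∈-++⁺ʳ tops (∈-cartesianProductWith⁺ off (∈-upTo⁺ (s≤s i≤i-max)) (∈highs⁺ j-min≤j j≤n)))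

  ordered : ∀ {i j k} → (i , j , k) ∈ triples → i ≤ j × j ≤ n
  ordered t∈ with ∈triples⁻ t∈
  ... | bottomᵏ i≤n       = ℕP.≤-refl , i≤n
  ... | topᵏ i+1<n        = ℕP.≤-refl , ℕP.<⇒≤ i+1<n
  ... | offᵏ i≤i-max j-min≤j j≤n  = ℕP.<⇒≤ (off-ordered i≤i-max j-min≤j) , j≤n

  kind⇒listed : ∀ {t} → Kind t → IsListedVertex n (point t)
  kind⇒listed (bottomᵏ {i} i≤n)       = inj₁ (i , 2 * i ∸ n , i≤n , inj₁ refl , refl)
  kind⇒listed (topᵏ {i} i+1<n)        = inj₁ (suc i , suc i , ℕP.<⇒≤ i+1<n , inj₂ refl , refl)
  kind⇒listed (offᵏ {i} {j} i≤i-max j-min≤j j≤n) = inj₂ (i , j , i≤i-max , j-min≤j , j≤n , refl)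

  ∈vertices⇒listed : ∀ {p} → p ∈ vertices → IsListedVertex n p
  ∈vertices⇒listed {p} p∈ = subst (IsListedVertex n) (sym (proj₂ (proj₂ t))) (kind⇒listed (∈triples⁻ (proj₁ (proj₂ t))))
    where
      t : ∃ λ t → t ∈ triples × p ≡ point t
      t = ∈-map⁻ point p∈

  diagonal-top∈ : ∀ {i} → i ≤ n → point (i , i , i) ∈ vertices
  diagonal-top∈ {zero} _ = subst (λ k → point (0 , 0 , k) ∈ vertices) (ℕP.0∸n≡0 n) (point∈ {bottom 0} (bottom∈ z≤n))
  diagonal-top∈ {suc m} 1+m≤n with suc m ℕP.≟ n
  ... | no 1+m≢n = point∈ {top m} (top∈ (ℕP.≤∧≢⇒< 1+m≤n 1+m≢n))
  ... | yes 1+m≡n = subst (λ i → point (i , i , i) ∈ vertices) (sym 1+m≡n)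
                          (subst (λ k → point (n , n , k) ∈ vertices) 2n∸n≡n (point∈ {bottom n} (bottom∈ ℕP.≤-refl)))
    where
      2n∸n≡n : 2 * n ∸ n ≡ n
      2n∸n≡n = trans (ℕP.m+n∸m≡n n (n + 0)) (ℕP.+-identityʳ n)

  listed⇒∈vertices : ∀ {p} → IsListedVertex n p → p ∈ vertices
  listed⇒∈vertices (inj₁ (i , _ , i≤n , inj₁ refl , refl)) = point∈ {bottom i} (bottom∈ i≤n)
  listed⇒∈vertices (inj₁ (i , _ , i≤n , inj₂ refl , refl)) = diagonal-top∈ i≤n
  listed⇒∈vertices (inj₂ (i , j , i≤i-max , j-min≤j , j≤n , refl)) = point∈ {off i j} (off∈ i≤i-max j-min≤j j≤n)

  off-not-diagonal : ∀ {i k} → (i , i , k) ∉ offs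
  off-not-diagonal t∈ with ∈-cartesianProductWith⁻ off (upTo (suc i-max)) highs t∈
  ... | _ , _ , i∈ , j∈ , refl = ℕP.<-irrefl refl (off-ordered (s≤s⁻¹ (∈-upTo⁻ i∈)) (proj₁ (∈highs⁻ j∈)))

  triples-unique : Unique triples
  triples-unique = UP.++⁺ bottoms-unique (UP.++⁺ tops-unique offs-unique tops#offs) bottoms#rest
    where
      bottoms-unique : Unique bottoms
      bottoms-unique = UP.applyUpTo⁺₁ bottom (suc n) (λ i<j _ → ℕP.<⇒≢ i<j ∘ cong proj₁)
      tops-unique : Unique tops
      tops-unique    = UP.applyUpTo⁺₁ top (n ∸ 1) (λ i<j _ → ℕP.<⇒≢ i<j ∘ ℕP.suc-injective ∘ cong proj₁)
      offs-unique : Unique offs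
      offs-unique    = UP.cartesianProductWith⁺ off (λ e → cong proj₁ e , cong (proj₁ ∘ proj₂) e) (UP.upTo⁺ (suc i-max))
                         (UP.applyUpTo⁺₁ (j-min +_) (suc n ∸ j-min) (λ i<j _ → ℕP.<⇒≢ i<j ∘ ℕP.+-cancelˡ-≡ j-min _ _))
      tops#offs : Disjoint tops offs
      tops#offs (t∈tops , t∈offs) with ∈-applyUpTo⁻ top t∈tops
      ... | _ , _ , refl = off-not-diagonal t∈offs
      bottoms#rest : Disjoint bottoms (tops ++ offs)
      bottoms#rest (t∈bottoms , t∈rest) with ∈-applyUpTo⁻ bottom t∈bottoms | ∈-++⁻ tops t∈rest
      ... | _ , _ , refl | inj₂ t∈offs = off-not-diagonal t∈offs
      ... | i , _ , refl | inj₁ t∈tops with ∈-applyUpTo⁻ top t∈tops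
      ...   | m , m<n-1 , bottom≡top = ℕP.<-irrefl L≡i (subst (λ i → 2 * i ∸ n < i) (sym i≡1+m) bottom<top)
        where
          i≡1+m : i ≡ suc m
          i≡1+m = cong proj₁ bottom≡top
          L≡i : 2 * i ∸ n ≡ i
          L≡i = trans (cong (proj₂ ∘ proj₂) bottom≡top) (sym i≡1+m)
          double : ∀ m → suc (suc m) + m ≡ 2 * suc m
          double = solve-∀
          m+2≤n : suc (suc m) ≤ n
          m+2≤n = subst (suc (suc m) ≤_) (ℕP.m+[n∸m]≡n n≥1) (s≤s m<n-1)
          bottom<top : 2 * suc m ∸ n < suc m
          bottom<top = s≤s (ℕP.m≤n+o⇒m∸n≤o (2 * suc m) n (subst (_≤ n + m) (double m) (ℕP.+-monoˡ-≤ m m+2≤n)))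

  vertices-unique : Unique vertices
  vertices-unique = Unique-map⁺ point point-injective triples-unique
    where
      point-injective : ∀ {t t'} → t ∈ triples → t' ∈ triples → point t ≡ point t' → t ≡ t'
      point-injective {_ , _ , _} {_ , _ , _} t∈ t'∈ =
        bn-injective (proj₁ (ordered t∈)) (proj₁ (ordered t'∈)) (proj₂ (ordered t∈)) (proj₂ (ordered t'∈))

  length-vertices : length vertices ≡ suc n + ((n ∸ 1) + suc i-max * (suc n ∸ j-min))
  length-vertices = begin
      length (map point triples)
        ≡⟨ LP.length-map point triples ⟩
      length (bottoms ++ tops ++ offs)
        ≡⟨ trans (LP.length-++ bottoms) (cong (length bottoms +_) (LP.length-++ tops)) ⟩
      length bottoms + (length tops + length offs)
        ≡⟨ cong₂ (λ x y → x + (y + length offs)) (LP.length-applyUpTo bottom (suc n)) (LP.length-applyUpTo top (n ∸ 1)) ⟩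
      suc n + ((n ∸ 1) + length offs)
        ≡⟨ cong (λ x → suc n + ((n ∸ 1) + x)) (length-cartesianProductWith off (upTo (suc i-max)) highs) ⟩
      suc n + ((n ∸ 1) + length (upTo (suc i-max)) * length highs)
        ≡⟨ cong₂ (λ x y → suc n + ((n ∸ 1) + x * y)) (LP.length-upTo (suc i-max)) (LP.length-applyUpTo (j-min +_) (suc n ∸ j-min)) ⟩
      suc n + ((n ∸ 1) + suc i-max * (suc n ∸ j-min)) ∎
    where open ≡-Reasoning

vertex-count : ℕ → ℕ
vertex-count n = suc n + ((n ∸ 1) + suc ⌊ n ∸ 1 /2⌋ * (suc n ∸ ⌈ n + 1 /2⌉))

vertex-count-even : ∀ m → vertex-count (2 * suc m) ≡ suc m * suc m + 2 * (2 * suc m)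
vertex-count-even m = begin
    suc n + ((n ∸ 1) + suc ⌊ n ∸ 1 /2⌋ * (suc n ∸ ⌈ n + 1 /2⌉))
      ≡⟨ cong₂ (λ x y → suc n + (x + suc ⌊ x /2⌋ * (suc n ∸ ⌊ y /2⌋))) (n-1≡ m) (n+2≡ m) ⟩
    suc n + (suc (m + m) + suc ⌊ suc (m + m) /2⌋ * (suc n ∸ ⌊ suc (suc m) + suc (suc m) /2⌋))
      ≡⟨ cong₂ (λ x y → suc n + (suc (m + m) + suc x * (suc n ∸ y))) (sym (ℕP.n≡⌈n+n/2⌉ m)) (sym (ℕP.n≡⌊n+n/2⌋ (suc (suc m)))) ⟩
    suc n + (suc (m + m) + suc m * (suc n ∸ suc (suc m)))
      ≡⟨ cong (λ z → suc n + (suc (m + m) + suc m * z)) (trans (cong (_∸ suc m) (n≡ m)) (ℕP.m+n∸m≡n (suc m) (suc m))) ⟩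
    suc n + (suc (m + m) + suc m * suc m)
      ≡⟨ total m ⟩
    suc m * suc m + 2 * n ∎
  where
    open ≡-Reasoning
    n : ℕ
    n = 2 * suc m
    n-1≡ : ∀ m → 2 * suc m ∸ 1 ≡ suc (m + m)
    n-1≡ m = trans (ℕP.+-suc m (m + 0)) (cong (λ x → suc (m + x)) (ℕP.+-identityʳ m))
    n+2≡ : ∀ m → suc (2 * suc m + 1) ≡ suc (suc m) + suc (suc m)
    n+2≡ = solve-∀
    n≡ : ∀ m → 2 * suc m ≡ suc m + suc m
    n≡ = solve-∀
    total : ∀ m → suc (2 * suc m) + (suc (m + m) + suc m * suc m) ≡ suc m * suc m + 2 * (2 * suc m)
    total = solve-∀

vertex-count-odd : ∀ m → vertex-count (2 * m + 1) ≡ suc m * suc m + 2 * (2 * m + 1)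
vertex-count-odd m = begin
    suc n + ((n ∸ 1) + suc ⌊ n ∸ 1 /2⌋ * (suc n ∸ ⌈ n + 1 /2⌉))
      ≡⟨ cong₂ (λ x y → suc n + (x + suc ⌊ x /2⌋ * (suc n ∸ ⌊ y /2⌋))) (n-1≡ m) (n+2≡ m) ⟩
    suc n + ((m + m) + suc ⌊ m + m /2⌋ * (suc n ∸ ⌊ suc (suc m + suc m) /2⌋))
      ≡⟨ cong₂ (λ x y → suc n + ((m + m) + suc x * (suc n ∸ y))) (sym (ℕP.n≡⌊n+n/2⌋ m)) (sym (ℕP.n≡⌈n+n/2⌉ (suc m))) ⟩
    suc n + ((m + m) + suc m * (suc n ∸ suc m))
      ≡⟨ cong (λ z → suc n + ((m + m) + suc m * z)) (trans (cong (_∸ suc m) (n+1≡ m)) (ℕP.m+n∸m≡n (suc m) (suc m))) ⟩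
    suc n + ((m + m) + suc m * suc m)
      ≡⟨ total m ⟩
    suc m * suc m + 2 * n ∎
  where
    open ≡-Reasoning
    n : ℕ
    n = 2 * m + 1
    n-1≡ : ∀ m → 2 * m + 1 ∸ 1 ≡ m + m
    n-1≡ m = trans (ℕP.m+n∸n≡m (2 * m) 1) (2*≡+ m)
    n+2≡ : ∀ m → suc (2 * m + 1 + 1) ≡ suc (suc m + suc m)
    n+2≡ = solve-∀
    n+1≡ : ∀ m → suc (2 * m + 1) ≡ suc m + suc m
    n+1≡ = solve-∀
    total : ∀ m → suc (2 * m + 1) + ((m + m) + suc m * suc m) ≡ suc m * suc m + 2 * (2 * m + 1)
    total = solve-∀

even-count : ∀ {n} m → 1 ≤ n → n ≡ 2 * m → vertex-count n ≡ m * m + 2 * n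
even-count {zero}  _       ()  _
even-count {suc _} zero    _   ()
even-count         (suc m) _   refl = vertex-count-even m

odd-count : ∀ {n} m → n ≡ 2 * m + 1 → vertex-count n ≡ suc m * suc m + 2 * n
odd-count m refl = vertex-count-odd m

theorem3p3 : (n : ℕ) → 1 ≤ n →
    ((p : Point n) → IsVertex n p ⇔ IsListedVertex n p)
  × Σ (List (Point n)) (λ L →
        Unique L
      × ((p : Point n) → p ∈ L ⇔ IsVertex n p)
      × ((m : ℕ) → n ≡ 2 * m → length L ≡ m * m + 2 * n)
      × ((m : ℕ) → n ≡ 2 * m + 1 → length L ≡ suc m * suc m + 2 * n))
theorem3p3 n n≥1 =
    (λ p → mk⇔ (vertex⇒listed p) (listed⇒vertex n≥1 p))
  , vertices
  , vertices-unique
  , (λ p → mk⇔ (listed⇒vertex n≥1 p ∘ ∈vertices⇒listed) (listed⇒∈vertices ∘ vertex⇒listed p))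
  , (λ m n≡2m → trans length-vertices (even-count m n≥1 n≡2m))
  , (λ m n≡2m+1 → trans length-vertices (odd-count m n≡2m+1))
  where open VertexList n n≥1
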